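{- Let $a_{n,k}$ be the number of permutations in $S_n$ with exactly $k$ bonds, for $n\ge1$, and set $a_{0,0}=1$ (and $a_{0,k}=0$ for $k\ge1$). Then, as formal power series, $$F(z,u):=\sum_{n,k\ge 0} a_{n,k}z^n u^k = \sum_{m\ge 0} m!\left(z+\frac{2z^2(u-1)}{1-z(u-1)}\right)^m.$$
   Context: A bond of a permutation $p=p_1\ldots p_n$ (one-line notation) is a pair of adjacent entries $(p_i,p_{i+1})$, $i\in[n-1]$, with $p_i-p_{i+1}=\pm 1$. -}

module Defs where

open import Data.Nat using (ℕ; zero; suc; _∸_)
open import Data.Nat.Base using (_!)
open import Relation.Nullary using (yes; no)
open import Data.Fin using (Fin; toℕ)
import Data.Fin.Properties as FinP
open import Data.Integer using (ℤ; +_; -_) renaming (_+_ to _+ℤ_; _*_ to _*ℤ_)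
open import Data.List using (List; []; _∷_; [_]; map; concatMap; allFin; filter; length)
open import Data.Vec using (Vec; toList) renaming ([] to []ᵥ; _∷_ to _∷ᵥ_)
import Data.List.Relation.Unary.Unique.DecPropositional as UDec
import Data.Nat as N

words : (n m : ℕ) → List (Vec (Fin m) n)
words zero    m = [ []ᵥ ]
words (suc n) m = concatMap (λ v → map (_∷ᵥ v) (allFin m)) (words n m)

-- S_n in one-line notation: the injective words of length n over Fin n
-- (entries 0..n-1 instead of 1..n; bonds are unaffected by the shift)
perms : (n : ℕ) → List (Vec (Fin n) n)
perms n = filter (λ v → UDec.unique? (FinP._≟_ {n}) (toList v)) (words n n)

isBond : ℕ → ℕ → ℕ
isBond x y with x ∸ y N.≟ 1 | y ∸ x N.≟ 1
... | yes _ | _ = 1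
... | no _  | yes _ = 1
... | no _  | no _ = 0

bondsL : List ℕ → ℕ
bondsL (x ∷ y ∷ rest) = isBond x y N.+ bondsL (y ∷ rest)
bondsL _ = 0

bonds : ∀ {n} → Vec (Fin n) n → ℕ
bonds v = bondsL (map toℕ (toList v))

-- a n k = number of permutations in S_n with exactly k bonds
-- (for n = 0 the single empty permutation has 0 bonds, so a 0 0 = 1, a 0 k = 0 for k ≥ 1)
a : ℕ → ℕ → ℕ
a n k = length (filter (λ p → bonds p N.≟ k) (perms n))

-- Formal power series in z, u over ℤ, as coefficient maps:
-- f n k = coefficient of z^n u^k.

Series : Set
Series = ℕ → ℕ → ℤ

sumTo : ℕ → (ℕ → ℤ) → ℤ
sumTo zero    h = h 0
sumTo (suc n) h = sumTo n h +ℤ h (suc n)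

const : ℤ → Series
const c zero zero = c
const c _    _    = + 0

one : Series
one = const (+ 1)

zS : Series
zS (suc zero) zero = + 1
zS _ _ = + 0

uS : Series
uS zero (suc zero) = + 1
uS _ _ = + 0

infixl 6 _⊕_ _⊖_
infixl 7 _⊛_

_⊕_ : Series → Series → Series
(f ⊕ g) n k = f n k +ℤ g n k

_⊖_ : Series → Series → Series
(f ⊖ g) n k = f n k +ℤ (- g n k)

_⊛_ : Series → Series → Series
(f ⊛ g) n k = sumTo n (λ i → sumTo k (λ j → f i j *ℤ g (n ∸ i) (k ∸ j)))

pow : Series → ℕ → Series
pow f zero    = one
pow f (suc m) = f ⊛ pow f m

-- Σ_{m ≥ 0} f m for a family in which f m has z-order ≥ m
-- (so only m ≤ n contribute to the coefficient of z^n)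
sumOrd : (ℕ → Series) → Series
sumOrd f n k = sumTo n (λ m → f m n k)

-- 1 / (1 - g) = Σ_j g^j, for g with zero z-constant term
geom : Series → Series
geom g = sumOrd (pow g)

-- w = z + 2 z^2 (u-1) / (1 - z(u-1))
wS : Series
wS = zS ⊕ const (+ 2) ⊛ zS ⊛ zS ⊛ (uS ⊖ one) ⊛ geom (zS ⊛ (uS ⊖ one))

rhs : Series
rhs = sumOrd (λ m → const (+ (m !)) ⊛ pow wS m)

F : Series
F n k = + (a n k)

-- Put X = u - 1 and let E(N, j) = Σ_q C(bonds q, j) over the permutations q of [N], i.e. the
-- number of permutations with j marked bonds. As u^b = Σ_j C(b, j) X^j, the coefficient of zⁿ
-- in F is Σ_j E(n, j) X^j. On the other side (1 - zX) w = z + z²X, so the coefficients of the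
-- powers of w satisfy a three-term recurrence, and by induction m! [z^(m+j)] w^m = E(m+j, j) X^j
-- as soon as E(N, 0) = N!, E(N+1, N+1) = 0 and
--   E(m+j+2, j+1) = (m+1) E(m+j+1, j+1) + E(m+j+1, j) + (m+1) E(m+j, j).
-- This recurrence comes from inserting the largest entry into a permutation: it can only bond
-- with its predecessor, so each insertion creates at most one bond and breaks at most one, and
-- sorting the insertions by these two bits produces the three terms (the last one after a
-- second insertion step, which accounts for insertions that both create and break a bond).

module Submission where

open import Defs
open import Level using (0ℓ)
open import Function using (_∘_)
open import Function.Bundles using (mk⇔)
open import Data.Empty using (⊥; ⊥-elim)
open import Data.Unit using (⊤; tt)
open import Data.Product using (_×_; _,_; proj₁; proj₂)
open import Data.Sum using (_⊎_; inj₁; inj₂)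
open import Data.Maybe using (Maybe; just; nothing)
open import Data.Nat using (ℕ; zero; suc; _+_; _*_; _∸_; _≤_; _<_; z≤n; s≤s; _!; _≟_; _<?_)
open import Data.Nat.Properties
import Data.Nat.Tactic.RingSolver as ℕ-Solver
open import Data.Nat.ListAction using (sum)
open import Data.Nat.ListAction.Properties using (sum-↭)
open import Data.Integer using (ℤ; +_; -_) renaming (_+_ to _+ℤ_; _*_ to _*ℤ_)
import Data.Integer.Properties as ℤ
import Data.Integer.Tactic.RingSolver as ℤ-Solver
open import Data.Fin using (Fin; toℕ; fromℕ<)
import Data.Fin.Properties as Fin
open import Data.Vec using (Vec; toList) renaming ([] to []ᵥ; _∷_ to _∷ᵥ_)
import Data.Vec as Vec using (tail)
import Data.Vec.Properties as Vec
open import Data.List using (List; []; _∷_; [_]; map; concatMap; length; _++_; filter; allFin)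
import Data.List.Properties as List
open import Data.List.Relation.Unary.All as All using (All; []; _∷_)
import Data.List.Relation.Unary.All.Properties as All
open import Data.List.Relation.Unary.Any as Any using (here; there)
open import Data.List.Relation.Unary.AllPairs using ([]; _∷_)
open import Data.List.Relation.Unary.Unique.Propositional using (Unique)
import Data.List.Relation.Unary.Unique.Propositional.Properties as Unique
import Data.List.Relation.Unary.Unique.DecPropositional as UniqueDec
open import Data.List.Membership.Propositional using (_∈_; _∉_; find)
open import Data.List.Membership.DecPropositional _≟_ using (_∈?_)
open import Data.List.Membership.Propositional.Properties
  using (∈-concatMap⁺; ∈-concatMap⁻; ∈-∃++; ∈-++⁺ʳ; ∈-map⁺; ∈-map⁻; ∈-filter⁺; ∈-filter⁻; ∈-allFin)
open import Data.List.Membership.Propositional.Properties.WithK using (unique∧set⇒bag)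
open import Data.List.Relation.Binary.BagAndSetEquality using (∼bag⇒↭)
import Data.List.Relation.Binary.Permutation.Propositional.Properties as ↭
open import Relation.Nullary using (yes; no; Dec)
open import Relation.Binary.Bundles using (Setoid)
open import Relation.Binary.PropositionalEquality hiding ([_])
import Relation.Binary.Reasoning.Setoid as SetoidReasoning

sumTo-cong : ∀ n {f g : ℕ → ℤ} → (∀ i → i ≤ n → f i ≡ g i) → sumTo n f ≡ sumTo n g
sumTo-cong zero    f≡g = f≡g 0 z≤n
sumTo-cong (suc n) f≡g =
  cong₂ _+ℤ_ (sumTo-cong n (λ i i≤n → f≡g i (m≤n⇒m≤1+n i≤n))) (f≡g (suc n) ≤-refl)

sumTo-zero : ∀ n {f : ℕ → ℤ} → (∀ i → i ≤ n → f i ≡ + 0) → sumTo n f ≡ + 0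
sumTo-zero n f≡0 = trans (sumTo-cong n f≡0) (sumTo-zeros n)
  where
  sumTo-zeros : ∀ n → sumTo n (λ _ → + 0) ≡ + 0
  sumTo-zeros zero    = refl
  sumTo-zeros (suc n) = cong (_+ℤ + 0) (sumTo-zeros n)

sumTo-distrib-+ : ∀ n (f g : ℕ → ℤ) → sumTo n (λ i → f i +ℤ g i) ≡ sumTo n f +ℤ sumTo n g
sumTo-distrib-+ zero    f g = refl
sumTo-distrib-+ (suc n) f g rewrite sumTo-distrib-+ n f g =
  interchange (sumTo n f) (sumTo n g) (f (suc n)) (g (suc n))
  where
  interchange : ∀ a b c d → a +ℤ b +ℤ (c +ℤ d) ≡ a +ℤ c +ℤ (b +ℤ d)
  interchange = ℤ-Solver.solve-∀

*-distribˡ-sumTo : ∀ n c (f : ℕ → ℤ) → c *ℤ sumTo n f ≡ sumTo n (λ i → c *ℤ f i)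
*-distribˡ-sumTo zero    c f = refl
*-distribˡ-sumTo (suc n) c f rewrite sym (*-distribˡ-sumTo n c f) =
  ℤ.*-distribˡ-+ c (sumTo n f) (f (suc n))

*-distribʳ-sumTo : ∀ n c (f : ℕ → ℤ) → sumTo n f *ℤ c ≡ sumTo n (λ i → f i *ℤ c)
*-distribʳ-sumTo n c f = begin
  sumTo n f *ℤ c             ≡⟨ ℤ.*-comm (sumTo n f) c ⟩
  c *ℤ sumTo n f             ≡⟨ *-distribˡ-sumTo n c f ⟩
  sumTo n (λ i → c *ℤ f i)   ≡⟨ sumTo-cong n (λ i _ → ℤ.*-comm c (f i)) ⟩
  sumTo n (λ i → f i *ℤ c)   ∎
  where open ≡-Reasoning

sumTo-suc : ∀ n (f : ℕ → ℤ) → sumTo (suc n) f ≡ f 0 +ℤ sumTo n (λ i → f (suc i))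
sumTo-suc zero    f = refl
sumTo-suc (suc n) f rewrite sumTo-suc n f = ℤ.+-assoc (f 0) _ _

sumTo-reverse : ∀ n (f : ℕ → ℤ) → sumTo n f ≡ sumTo n (λ i → f (n ∸ i))
sumTo-reverse zero    f = refl
sumTo-reverse (suc n) f = begin
  sumTo n f +ℤ f (suc n)
    ≡⟨ cong (_+ℤ f (suc n)) (sumTo-reverse n f) ⟩
  sumTo n (λ i → f (n ∸ i)) +ℤ f (suc n)
    ≡⟨ ℤ.+-comm (sumTo n (λ i → f (n ∸ i))) (f (suc n)) ⟩
  f (suc n) +ℤ sumTo n (λ i → f (suc n ∸ suc i))
    ≡⟨ sumTo-suc n (λ i → f (suc n ∸ i)) ⟨
  sumTo (suc n) (λ i → f (suc n ∸ i)) ∎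
  where open ≡-Reasoning

sumTo-single : ∀ n d {f : ℕ → ℤ} → d ≤ n → (∀ i → i ≤ n → i ≢ d → f i ≡ + 0) →
               sumTo n f ≡ f d
sumTo-single zero    zero    _   _   = refl
sumTo-single (suc n) d   {f} d≤n off with d ≟ suc n
... | yes refl = trans (cong (_+ℤ f (suc n)) rest≡0) (ℤ.+-identityˡ _)
  where
  rest≡0 : sumTo n f ≡ + 0
  rest≡0 = sumTo-zero n (λ i i≤n → off i (m≤n⇒m≤1+n i≤n) (<⇒≢ (s≤s i≤n)))
... | no d≢1+n = trans (cong₂ _+ℤ_ init last≡0) (ℤ.+-identityʳ _)
  where
  init : sumTo n f ≡ f d
  init = sumTo-single n d (≤-pred (≤∧≢⇒< d≤n d≢1+n)) (λ i i≤n → off i (m≤n⇒m≤1+n i≤n))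
  last≡0 : f (suc n) ≡ + 0
  last≡0 = off (suc n) ≤-refl (λ e → d≢1+n (sym e))

sumTo-swap : ∀ n m (f : ℕ → ℕ → ℤ) →
             sumTo n (λ i → sumTo m (f i)) ≡ sumTo m (λ j → sumTo n (λ i → f i j))
sumTo-swap zero    m f = refl
sumTo-swap (suc n) m f rewrite sumTo-swap n m f =
  sym (sumTo-distrib-+ m (λ j → sumTo n (λ i → f i j)) (f (suc n)))

sumTo-triangle : ∀ n (g : ℕ → ℕ → ℤ) →
                 sumTo n (λ i → sumTo (n ∸ i) (g i)) ≡ sumTo n (λ s → sumTo s (λ i → g i (s ∸ i)))
sumTo-triangle zero    g = refl
sumTo-triangle (suc n) g = begin
  sumTo n (λ i → sumTo (suc n ∸ i) (g i)) +ℤ sumTo (n ∸ n) (g (suc n))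
    ≡⟨ cong₂ _+ℤ_ (sumTo-cong n (λ i i≤n → cong (λ k → sumTo k (g i)) (+-∸-assoc 1 i≤n)))
                  (cong (λ k → sumTo k (g (suc n))) (n∸n≡0 n)) ⟩
  sumTo n (λ i → sumTo (n ∸ i) (g i) +ℤ g i (suc (n ∸ i))) +ℤ g (suc n) 0
    ≡⟨ cong (_+ℤ g (suc n) 0) (sumTo-distrib-+ n _ _) ⟩
  sumTo n (λ i → sumTo (n ∸ i) (g i)) +ℤ sumTo n (λ i → g i (suc (n ∸ i))) +ℤ g (suc n) 0
    ≡⟨ ℤ.+-assoc (sumTo n (λ i → sumTo (n ∸ i) (g i))) _ _ ⟩
  sumTo n (λ i → sumTo (n ∸ i) (g i)) +ℤ (sumTo n (λ i → g i (suc (n ∸ i))) +ℤ g (suc n) 0)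
    ≡⟨ cong₂ _+ℤ_ (sumTo-triangle n g)
         (cong₂ _+ℤ_ (sumTo-cong n (λ i i≤n → cong (g i) (sym (+-∸-assoc 1 i≤n))))
                     (cong (g (suc n)) (sym (n∸n≡0 (suc n))))) ⟩
  sumTo n (λ s → sumTo s (λ i → g i (s ∸ i))) +ℤ sumTo (suc n) (λ i → g i (suc n ∸ i)) ∎
  where open ≡-Reasoning

-- Polynomials in u, as coefficient maps

Poly : Set
Poly = ℕ → ℤ

infix 4 _≈_
record _≈_ (a b : Poly) : Set where
  constructor mk≈
  field at : ∀ k → a k ≡ b k
open _≈_

≈-refl : ∀ {a} → a ≈ a
≈-refl = mk≈ λ _ → refl

≈-sym : ∀ {a b} → a ≈ b → b ≈ a
≈-sym a≈b = mk≈ λ k → sym (at a≈b k)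

≈-trans : ∀ {a b c} → a ≈ b → b ≈ c → a ≈ c
≈-trans a≈b b≈c = mk≈ λ k → trans (at a≈b k) (at b≈c k)

≈-setoid : Setoid 0ℓ 0ℓ
≈-setoid = record
  { Carrier = Poly ; _≈_ = _≈_
  ; isEquivalence = record { refl = ≈-refl ; sym = ≈-sym ; trans = ≈-trans } }

module ≈-Reasoning = SetoidReasoning ≈-setoid

infixl 6 _+ₚ_
infixl 7 _*ₚ_
infixr 8 _·_

_+ₚ_ : Poly → Poly → Poly
(a +ₚ b) k = a k +ℤ b k

_*ₚ_ : Poly → Poly → Poly
(a *ₚ b) k = sumTo k (λ j → a j *ℤ b (k ∸ j))

_·_ : ℤ → Poly → Poly
(c · a) k = c *ℤ a k

0ₚ 1ₚ X : Poly
0ₚ _ = + 0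
1ₚ   = one 0
X    = (uS ⊖ one) 0

_^ₚ_ : Poly → ℕ → Poly
a ^ₚ zero  = 1ₚ
a ^ₚ suc m = a *ₚ a ^ₚ m

sumₚ : ℕ → (ℕ → Poly) → Poly
sumₚ n h k = sumTo n (λ i → h i k)

+ₚ-cong : ∀ {a a′ b b′} → a ≈ a′ → b ≈ b′ → a +ₚ b ≈ a′ +ₚ b′
+ₚ-cong a≈ b≈ = mk≈ λ k → cong₂ _+ℤ_ (at a≈ k) (at b≈ k)

+ₚ-congˡ : ∀ a {b b′} → b ≈ b′ → a +ₚ b ≈ a +ₚ b′
+ₚ-congˡ a = +ₚ-cong (≈-refl {a})

*ₚ-cong : ∀ {a a′ b b′} → a ≈ a′ → b ≈ b′ → a *ₚ b ≈ a′ *ₚ b′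
*ₚ-cong a≈ b≈ = mk≈ λ k → sumTo-cong k (λ j _ → cong₂ _*ℤ_ (at a≈ j) (at b≈ (k ∸ j)))

*ₚ-congˡ : ∀ a {b b′} → b ≈ b′ → a *ₚ b ≈ a *ₚ b′
*ₚ-congˡ a = *ₚ-cong (≈-refl {a})

*ₚ-congʳ : ∀ b {a a′} → a ≈ a′ → a *ₚ b ≈ a′ *ₚ b
*ₚ-congʳ b a≈ = *ₚ-cong a≈ (≈-refl {b})

·-congˡ : ∀ c {a b} → a ≈ b → c · a ≈ c · b
·-congˡ c a≈b = mk≈ λ k → cong (c *ℤ_) (at a≈b k)

sumₚ-cong : ∀ n {h h′ : ℕ → Poly} → (∀ i → i ≤ n → h i ≈ h′ i) → sumₚ n h ≈ sumₚ n h′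
sumₚ-cong n h≈ = mk≈ λ k → sumTo-cong n (λ i i≤n → at (h≈ i i≤n) k)

sumₚ-suc : ∀ n h → sumₚ (suc n) h ≈ h 0 +ₚ sumₚ n (λ i → h (suc i))
sumₚ-suc n h = mk≈ λ k → sumTo-suc n (λ i → h i k)

sumₚ-distrib-+ₚ : ∀ n h h′ → sumₚ n (λ i → h i +ₚ h′ i) ≈ sumₚ n h +ₚ sumₚ n h′
sumₚ-distrib-+ₚ n h h′ = mk≈ λ k → sumTo-distrib-+ n (λ i → h i k) (λ i → h′ i k)

+ₚ-identityˡ : ∀ a → 0ₚ +ₚ a ≈ a
+ₚ-identityˡ a = mk≈ λ k → ℤ.+-identityˡ (a k)

+ₚ-identityʳ : ∀ a → a +ₚ 0ₚ ≈ a
+ₚ-identityʳ a = mk≈ λ k → ℤ.+-identityʳ (a k)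

*ₚ-comm : ∀ a b → a *ₚ b ≈ b *ₚ a
*ₚ-comm a b = mk≈ λ k → trans (sumTo-reverse k _) (sumTo-cong k (λ j j≤k →
  trans (ℤ.*-comm (a (k ∸ j)) (b (k ∸ (k ∸ j))))
        (cong (λ t → b t *ℤ a (k ∸ j)) (m∸[m∸n]≡n j≤k))))

*ₚ-distribˡ-+ₚ : ∀ a b c → a *ₚ (b +ₚ c) ≈ a *ₚ b +ₚ a *ₚ c
*ₚ-distribˡ-+ₚ a b c = mk≈ λ k →
  trans (sumTo-cong k (λ j _ → ℤ.*-distribˡ-+ (a j) _ _)) (sumTo-distrib-+ k _ _)

*ₚ-distribʳ-+ₚ : ∀ a b c → (b +ₚ c) *ₚ a ≈ b *ₚ a +ₚ c *ₚ a
*ₚ-distribʳ-+ₚ a b c = begin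
  (b +ₚ c) *ₚ a      ≈⟨ *ₚ-comm (b +ₚ c) a ⟩
  a *ₚ (b +ₚ c)      ≈⟨ *ₚ-distribˡ-+ₚ a b c ⟩
  a *ₚ b +ₚ a *ₚ c   ≈⟨ +ₚ-cong (*ₚ-comm a b) (*ₚ-comm a c) ⟩
  b *ₚ a +ₚ c *ₚ a   ∎
  where open ≈-Reasoning

*ₚ-assoc : ∀ a b c → (a *ₚ b) *ₚ c ≈ a *ₚ (b *ₚ c)
*ₚ-assoc a b c = mk≈ λ k → sym (begin
  sumTo k (λ i → a i *ℤ sumTo (k ∸ i) (λ j → b j *ℤ c (k ∸ i ∸ j)))
    ≡⟨ sumTo-cong k (λ i _ → *-distribˡ-sumTo (k ∸ i) (a i) _) ⟩
  sumTo k (λ i → sumTo (k ∸ i) (λ j → a i *ℤ (b j *ℤ c (k ∸ i ∸ j))))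
    ≡⟨ sumTo-triangle k (λ i j → a i *ℤ (b j *ℤ c (k ∸ i ∸ j))) ⟩
  sumTo k (λ s → sumTo s (λ i → a i *ℤ (b (s ∸ i) *ℤ c (k ∸ i ∸ (s ∸ i)))))
    ≡⟨ sumTo-cong k (λ s _ → sumTo-cong s (λ i i≤s →
         trans (sym (ℤ.*-assoc (a i) (b (s ∸ i)) _))
               (cong (λ t → a i *ℤ b (s ∸ i) *ℤ c t) (k∸i∸[s∸i]≡k∸s i≤s)))) ⟩
  sumTo k (λ s → sumTo s (λ i → a i *ℤ b (s ∸ i) *ℤ c (k ∸ s)))
    ≡⟨ sumTo-cong k (λ s _ → sym (*-distribʳ-sumTo s (c (k ∸ s)) _)) ⟩
  sumTo k (λ s → sumTo s (λ i → a i *ℤ b (s ∸ i)) *ℤ c (k ∸ s)) ∎)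
  where
  open ≡-Reasoning
  k∸i∸[s∸i]≡k∸s : ∀ {k s i} → i ≤ s → k ∸ i ∸ (s ∸ i) ≡ k ∸ s
  k∸i∸[s∸i]≡k∸s {k} {s} {i} i≤s = trans (∸-+-assoc k i (s ∸ i)) (cong (k ∸_) (m+[n∸m]≡n i≤s))

*ₚ-identityˡ : ∀ a → 1ₚ *ₚ a ≈ a
*ₚ-identityˡ a = mk≈ coeff
  where
  coeff : ∀ k → (1ₚ *ₚ a) k ≡ a k
  coeff zero    = ℤ.*-identityˡ (a 0)
  coeff (suc k) = trans (sumTo-single (suc k) 0 z≤n off) (ℤ.*-identityˡ (a (suc k)))
    where
    off : ∀ i → i ≤ suc k → i ≢ 0 → 1ₚ i *ℤ a (suc k ∸ i) ≡ + 0
    off zero    _ i≢0 = ⊥-elim (i≢0 refl)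
    off (suc i) _ _   = refl

*ₚ-identityʳ : ∀ a → a *ₚ 1ₚ ≈ a
*ₚ-identityʳ a = ≈-trans (*ₚ-comm a 1ₚ) (*ₚ-identityˡ a)

*ₚ-zeroˡ : ∀ a → 0ₚ *ₚ a ≈ 0ₚ
*ₚ-zeroˡ a = mk≈ λ k → sumTo-zero k (λ _ _ → refl)

*ₚ-zeroʳ : ∀ a → a *ₚ 0ₚ ≈ 0ₚ
*ₚ-zeroʳ a = ≈-trans (*ₚ-comm a 0ₚ) (*ₚ-zeroˡ a)

·-*ₚ-assoc : ∀ c a b → c · a *ₚ b ≈ c · (a *ₚ b)
·-*ₚ-assoc c a b = mk≈ λ k →
  trans (sumTo-cong k (λ j _ → ℤ.*-assoc c _ _)) (sym (*-distribˡ-sumTo k c _))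

*ₚ-·-comm : ∀ c a b → a *ₚ c · b ≈ c · (a *ₚ b)
*ₚ-·-comm c a b = begin
  a *ₚ c · b     ≈⟨ *ₚ-comm a (c · b) ⟩
  c · b *ₚ a     ≈⟨ ·-*ₚ-assoc c b a ⟩
  c · (b *ₚ a)   ≈⟨ ·-congˡ c (*ₚ-comm b a) ⟩
  c · (a *ₚ b)   ∎
  where open ≈-Reasoning

*ₚ-comm-middle : ∀ a b c → a *ₚ (b *ₚ c) ≈ b *ₚ (a *ₚ c)
*ₚ-comm-middle a b c = begin
  a *ₚ (b *ₚ c)   ≈⟨ *ₚ-assoc a b c ⟨
  a *ₚ b *ₚ c     ≈⟨ *ₚ-congʳ c (*ₚ-comm a b) ⟩
  b *ₚ a *ₚ c     ≈⟨ *ₚ-assoc b a c ⟩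
  b *ₚ (a *ₚ c)   ∎
  where open ≈-Reasoning

·-*ₚ-congˡ : ∀ a c d {p q} → c · p ≈ d · q → c · (a *ₚ p) ≈ d · (a *ₚ q)
·-*ₚ-congˡ a c d {p} {q} cp≈dq = begin
  c · (a *ₚ p)    ≈⟨ *ₚ-·-comm c a p ⟨
  a *ₚ c · p      ≈⟨ *ₚ-congˡ a cp≈dq ⟩
  a *ₚ d · q      ≈⟨ *ₚ-·-comm d a q ⟩
  d · (a *ₚ q)    ∎
  where open ≈-Reasoning

·-distribʳ-+ℤ : ∀ c d a → (c +ℤ d) · a ≈ c · a +ₚ d · a
·-distribʳ-+ℤ c d a = mk≈ λ k → ℤ.*-distribʳ-+ (a k) c d

*ₚ-distribˡ-sumₚ : ∀ n a h → a *ₚ sumₚ n h ≈ sumₚ n (λ i → a *ₚ h i)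
*ₚ-distribˡ-sumₚ n a h = mk≈ λ k →
  trans (sumTo-cong k (λ j _ → *-distribˡ-sumTo n (a j) _)) (sumTo-swap k n _)

sumₚ-zero : ∀ n {h : ℕ → Poly} → (∀ i → i ≤ n → h i ≈ 0ₚ) → sumₚ n h ≈ 0ₚ
sumₚ-zero n h≈0 = mk≈ λ k → sumTo-zero n (λ i i≤n → at (h≈0 i i≤n) k)

sumₚ-single : ∀ n d {h : ℕ → Poly} → d ≤ n → (∀ i → i ≤ n → i ≢ d → h i ≈ 0ₚ) → sumₚ n h ≈ h d
sumₚ-single n d d≤n off = mk≈ λ k → sumTo-single n d d≤n (λ i i≤n i≢d → at (off i i≤n i≢d) k)

^ₚ-cong : ∀ {a b} m → a ≈ b → a ^ₚ m ≈ b ^ₚ m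
^ₚ-cong zero    _   = ≈-refl
^ₚ-cong (suc m) a≈b = *ₚ-cong a≈b (^ₚ-cong m a≈b)

1ₚ^ₚ : ∀ m → 1ₚ ^ₚ m ≈ 1ₚ
1ₚ^ₚ zero    = ≈-refl
1ₚ^ₚ (suc m) = ≈-trans (*ₚ-identityˡ (1ₚ ^ₚ m)) (1ₚ^ₚ m)

-- Power series: the coefficient of zⁿ in a Series is a Poly

shiftₛ : Series → Series
shiftₛ f n = f (suc n)

⊛-suc : ∀ f g n → f 0 ≈ 0ₚ → (f ⊛ g) (suc n) ≈ (shiftₛ f ⊛ g) n
⊛-suc f g n f₀≈0 = begin
  (f ⊛ g) (suc n)                                    ≈⟨ sumₚ-suc n (λ i → f i *ₚ g (suc n ∸ i)) ⟩
  f 0 *ₚ g (suc n) +ₚ (shiftₛ f ⊛ g) n               ≈⟨ +ₚ-cong (*ₚ-congʳ (g (suc n)) f₀≈0) ≈-refl ⟩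
  0ₚ *ₚ g (suc n) +ₚ (shiftₛ f ⊛ g) n                ≈⟨ +ₚ-cong (*ₚ-zeroˡ (g (suc n))) ≈-refl ⟩
  0ₚ +ₚ (shiftₛ f ⊛ g) n                             ≈⟨ +ₚ-identityˡ _ ⟩
  (shiftₛ f ⊛ g) n                                   ∎
  where open ≈-Reasoning

⊛-distribʳ-⊕ : ∀ f g h n → ((f ⊕ g) ⊛ h) n ≈ (f ⊛ h) n +ₚ (g ⊛ h) n
⊛-distribʳ-⊕ f g h n = ≈-trans (sumₚ-cong n (λ i _ → *ₚ-distribʳ-+ₚ (h (n ∸ i)) (f i) (g i)))
                               (sumₚ-distrib-+ₚ n _ _)

⊛-factorˡ : ∀ a f g h n → (∀ i → f i ≈ a *ₚ g i) → (f ⊛ h) n ≈ a *ₚ (g ⊛ h) n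
⊛-factorˡ a f g h n f≈ag = begin
  (f ⊛ h) n                                    ≈⟨ sumₚ-cong n (λ i _ → *ₚ-congʳ (h (n ∸ i)) (f≈ag i)) ⟩
  sumₚ n (λ i → a *ₚ g i *ₚ h (n ∸ i))         ≈⟨ sumₚ-cong n (λ i _ → *ₚ-assoc a (g i) (h (n ∸ i))) ⟩
  sumₚ n (λ i → a *ₚ (g i *ₚ h (n ∸ i)))       ≈⟨ *ₚ-distribˡ-sumₚ n a (λ i → g i *ₚ h (n ∸ i)) ⟨
  a *ₚ (g ⊛ h) n                               ∎
  where open ≈-Reasoning

record Monomial (f : Series) (d : ℕ) (c : Poly) : Set where
  field
    coeff : f d ≈ c
    off   : ∀ i → i ≢ d → f i ≈ 0ₚ
open Monomial

monomial-⊛ : ∀ {f d c} → Monomial f d c → ∀ g n → (f ⊛ g) (d + n) ≈ c *ₚ g n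
monomial-⊛ {f} {d} {c} mono g n = begin
  (f ⊛ g) (d + n)                  ≈⟨ sumₚ-single (d + n) d (m≤m+n d n) off′ ⟩
  f d *ₚ g (d + n ∸ d)             ≈⟨ *ₚ-cong (coeff mono) (mk≈ λ k → cong (λ t → g t k) (m+n∸m≡n d n)) ⟩
  c *ₚ g n                         ∎
  where
  open ≈-Reasoning
  off′ : ∀ i → i ≤ d + n → i ≢ d → f i *ₚ g (d + n ∸ i) ≈ 0ₚ
  off′ i _ i≢d = ≈-trans (*ₚ-congʳ (g (d + n ∸ i)) (off mono i i≢d)) (*ₚ-zeroˡ (g (d + n ∸ i)))

monomial-⊛-below : ∀ {f d c} → Monomial f d c → ∀ g n → n < d → (f ⊛ g) n ≈ 0ₚ
monomial-⊛-below mono g n n<d = sumₚ-zero n (λ i i≤n →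
  ≈-trans (*ₚ-congʳ (g (n ∸ i)) (off mono i (λ i≡d → <⇒≢ (≤-<-trans i≤n n<d) i≡d)))
          (*ₚ-zeroˡ (g (n ∸ i))))

monomial-⊛-monomial : ∀ {f d c g e c′} → Monomial f d c → Monomial g e c′ →
                      Monomial (f ⊛ g) (d + e) (c *ₚ c′)
monomial-⊛-monomial {f} {d} {c} {g} {e} {c′} f-mono g-mono = record
  { coeff = ≈-trans (monomial-⊛ f-mono g e) (*ₚ-congˡ c (coeff g-mono))
  ; off   = off′ }
  where
  off′ : ∀ i → i ≢ d + e → (f ⊛ g) i ≈ 0ₚ
  off′ i i≢d+e with i <? d
  ... | yes i<d = monomial-⊛-below f-mono g i i<d
  ... | no  i≮d = begin
    (f ⊛ g) i                  ≈⟨ mk≈ (λ k → cong (λ t → (f ⊛ g) t k) (sym d+[i∸d]≡i)) ⟩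
    (f ⊛ g) (d + (i ∸ d))      ≈⟨ monomial-⊛ f-mono g (i ∸ d) ⟩
    c *ₚ g (i ∸ d)             ≈⟨ *ₚ-congˡ c (off g-mono (i ∸ d) i∸d≢e) ⟩
    c *ₚ 0ₚ                    ≈⟨ *ₚ-zeroʳ c ⟩
    0ₚ                         ∎
    where
    open ≈-Reasoning
    d+[i∸d]≡i : d + (i ∸ d) ≡ i
    d+[i∸d]≡i = m+[n∸m]≡n (≮⇒≥ i≮d)
    i∸d≢e : i ∸ d ≢ e
    i∸d≢e i∸d≡e = i≢d+e (trans (sym d+[i∸d]≡i) (cong (λ t → d + t) i∸d≡e))

pow-monomial : ∀ {f d c} → Monomial f d c → ∀ m → Monomial (pow f m) (m * d) (c ^ₚ m)
pow-monomial mono zero    = record { coeff = ≈-refl ; off = one-off }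
  where
  one-off : ∀ i → i ≢ 0 → one i ≈ 0ₚ
  one-off zero    i≢0 = ⊥-elim (i≢0 refl)
  one-off (suc i) _   = mk≈ λ { zero → refl ; (suc k) → refl }
pow-monomial mono (suc m) = monomial-⊛-monomial mono (pow-monomial mono m)

geom-monomial : ∀ {g c} → Monomial g 1 c → ∀ n → geom g n ≈ c ^ₚ n
geom-monomial {g} {c} mono n = begin
  geom g n         ≈⟨ sumₚ-single n n ≤-refl (λ m _ m≢n → off (pow-mono m) n (λ n≡m → m≢n (sym n≡m))) ⟩
  pow g n n        ≈⟨ coeff (pow-mono n) ⟩
  c ^ₚ n           ∎
  where
  open ≈-Reasoning
  pow-mono : ∀ m → Monomial (pow g m) m (c ^ₚ m)
  pow-mono m = subst (λ e → Monomial (pow g m) e (c ^ₚ m)) (*-identityʳ m) (pow-monomial mono m)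

pow-below : ∀ f m n → f 0 ≈ 0ₚ → n < m → pow f m n ≈ 0ₚ
pow-below f (suc m) zero    f₀≈0 _ = ≈-trans (*ₚ-congʳ (pow f m 0) f₀≈0) (*ₚ-zeroˡ (pow f m 0))
pow-below f (suc m) (suc n) f₀≈0 (s≤s n<m) = ≈-trans (⊛-suc f (pow f m) n f₀≈0)
  (sumₚ-zero n (λ i _ → ≈-trans (*ₚ-congˡ (f (suc i)) (pow-below f m (n ∸ i) f₀≈0 (≤-<-trans (m∸n≤m n i) n<m)))
                                (*ₚ-zeroʳ (f (suc i)))))

pow-diagonal : ∀ f m → f 0 ≈ 0ₚ → pow f m m ≈ f 1 ^ₚ m
pow-diagonal f zero    f₀≈0 = ≈-refl
pow-diagonal f (suc m) f₀≈0 = begin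
  pow f (suc m) (suc m)                  ≈⟨ ⊛-suc f (pow f m) m f₀≈0 ⟩
  (shiftₛ f ⊛ pow f m) m                 ≈⟨ sumₚ-single m 0 z≤n off′ ⟩
  f 1 *ₚ pow f m m                       ≈⟨ *ₚ-congˡ (f 1) (pow-diagonal f m f₀≈0) ⟩
  f 1 ^ₚ suc m                           ∎
  where
  open ≈-Reasoning
  off′ : ∀ i → i ≤ m → i ≢ 0 → f (suc i) *ₚ pow f m (m ∸ i) ≈ 0ₚ
  off′ zero    _   i≢0 = ⊥-elim (i≢0 refl)
  off′ (suc i) i<m _   = ≈-trans (*ₚ-congˡ (f (suc (suc i))) (pow-below f m (m ∸ suc i) f₀≈0 (∸-monoʳ-< (s≤s z≤n) i<m)))
                                 (*ₚ-zeroʳ (f (suc (suc i))))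

zS-monomial : Monomial zS 1 1ₚ
zS-monomial = record { coeff = mk≈ λ { zero → refl ; (suc k) → refl } ; off = zS-off }
  where
  zS-off : ∀ i → i ≢ 1 → zS i ≈ 0ₚ
  zS-off zero          _   = ≈-refl
  zS-off (suc zero)    i≢1 = ⊥-elim (i≢1 refl)
  zS-off (suc (suc i)) _   = ≈-refl

const-monomial : ∀ c → Monomial (const c) 0 (c · 1ₚ)
const-monomial c = record
  { coeff = mk≈ λ { zero → sym (ℤ.*-identityʳ c) ; (suc k) → sym (ℤ.*-zeroʳ c) }
  ; off   = λ { zero i≢0 → ⊥-elim (i≢0 refl) ; (suc i) _ → mk≈ λ { zero → refl ; (suc k) → refl } } }

u-1-monomial : Monomial (uS ⊖ one) 0 X
u-1-monomial = record
  { coeff = ≈-refl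
  ; off   = λ { zero i≢0 → ⊥-elim (i≢0 refl)
              ; (suc i) _ → mk≈ λ { zero → refl ; (suc zero) → refl ; (suc (suc k)) → refl } } }

zX : Series
zX = zS ⊛ (uS ⊖ one)

zX-monomial : Monomial zX 1 X
zX-monomial = record { coeff = ≈-trans (coeff mono) (*ₚ-identityˡ X) ; off = off mono }
  where mono = monomial-⊛-monomial zS-monomial u-1-monomial

2X : Poly
2X = (+ 2) · X

2z²X-monomial : Monomial (const (+ 2) ⊛ zS ⊛ zS ⊛ (uS ⊖ one)) 2 2X
2z²X-monomial = record { coeff = ≈-trans (coeff mono) 2·1·1·1·X≈2X ; off = off mono }
  where
  mono = monomial-⊛-monomial (monomial-⊛-monomial (monomial-⊛-monomial (const-monomial (+ 2))
           zS-monomial) zS-monomial) u-1-monomial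
  2·1·1·1·X≈2X : (+ 2) · 1ₚ *ₚ 1ₚ *ₚ 1ₚ *ₚ X ≈ 2X
  2·1·1·1·X≈2X = begin
    (+ 2) · 1ₚ *ₚ 1ₚ *ₚ 1ₚ *ₚ X   ≈⟨ *ₚ-congʳ X (≈-trans (*ₚ-identityʳ ((+ 2) · 1ₚ *ₚ 1ₚ))
                                                       (*ₚ-identityʳ ((+ 2) · 1ₚ))) ⟩
    (+ 2) · 1ₚ *ₚ X               ≈⟨ ·-*ₚ-assoc (+ 2) 1ₚ X ⟩
    (+ 2) · (1ₚ *ₚ X)             ≈⟨ ·-congˡ (+ 2) (*ₚ-identityˡ X) ⟩
    2X                            ∎
    where open ≈-Reasoning

wTail : Series
wTail = const (+ 2) ⊛ zS ⊛ zS ⊛ (uS ⊖ one) ⊛ geom zX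

w-split : ∀ n → wS n ≈ zS n +ₚ wTail n
w-split n = ≈-refl

wTail-0 : wTail 0 ≈ 0ₚ
wTail-0 = monomial-⊛-below 2z²X-monomial (geom zX) 0 (s≤s z≤n)

wTail-1 : wTail 1 ≈ 0ₚ
wTail-1 = monomial-⊛-below 2z²X-monomial (geom zX) 1 (s≤s (s≤s z≤n))

wTail-2+ : ∀ n → wTail (2 + n) ≈ 2X *ₚ X ^ₚ n
wTail-2+ n = ≈-trans (monomial-⊛ 2z²X-monomial (geom zX) n) (*ₚ-congˡ 2X (geom-monomial zX-monomial n))

wTail-3+ : ∀ n → wTail (3 + n) ≈ X *ₚ wTail (2 + n)
wTail-3+ n = begin
  wTail (3 + n)              ≈⟨ wTail-2+ (suc n) ⟩
  2X *ₚ (X *ₚ X ^ₚ n)        ≈⟨ *ₚ-comm-middle 2X X (X ^ₚ n) ⟩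
  X *ₚ (2X *ₚ X ^ₚ n)        ≈⟨ *ₚ-congˡ X (wTail-2+ n) ⟨
  X *ₚ wTail (2 + n)         ∎
  where open ≈-Reasoning

w-0 : wS 0 ≈ 0ₚ
w-0 = ≈-trans (w-split 0) (≈-trans (+ₚ-congˡ (zS 0) wTail-0) (+ₚ-identityˡ 0ₚ))

w-1 : wS 1 ≈ 1ₚ
w-1 = ≈-trans (w-split 1) (≈-trans (+ₚ-cong (coeff zS-monomial) wTail-1) (+ₚ-identityʳ 1ₚ))

wTail⊛-1 : ∀ P → (wTail ⊛ P) 1 ≈ 0ₚ
wTail⊛-1 P = begin
  (wTail ⊛ P) 1        ≈⟨ ⊛-suc wTail P 0 wTail-0 ⟩
  wTail 1 *ₚ P 0       ≈⟨ *ₚ-congʳ (P 0) wTail-1 ⟩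
  0ₚ *ₚ P 0            ≈⟨ *ₚ-zeroˡ (P 0) ⟩
  0ₚ                   ∎
  where open ≈-Reasoning

wTail⊛-2+ : ∀ P n → (wTail ⊛ P) (2 + n) ≈ 2X *ₚ P n +ₚ X *ₚ (wTail ⊛ P) (suc n)
wTail⊛-2+ P n = begin
  (wTail ⊛ P) (2 + n)            ≈⟨ ⊛-suc wTail P (suc n) wTail-0 ⟩
  (wTail₁ ⊛ P) (suc n)           ≈⟨ ⊛-suc wTail₁ P n wTail-1 ⟩
  (wTail₂ ⊛ P) n                 ≈⟨ tail-step n ⟩
  2X *ₚ P n +ₚ X *ₚ (wTail ⊛ P) (suc n) ∎
  where
  open ≈-Reasoning
  wTail₁ wTail₂ : Series
  wTail₁ = shiftₛ wTail
  wTail₂ = shiftₛ wTail₁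
  wTail-2 : wTail 2 ≈ 2X
  wTail-2 = ≈-trans (wTail-2+ 0) (*ₚ-identityʳ 2X)
  tail-step : ∀ n → (wTail₂ ⊛ P) n ≈ 2X *ₚ P n +ₚ X *ₚ (wTail ⊛ P) (suc n)
  tail-step zero = begin
    wTail 2 *ₚ P 0                 ≈⟨ *ₚ-congʳ (P 0) wTail-2 ⟩
    2X *ₚ P 0                      ≈⟨ +ₚ-identityʳ (2X *ₚ P 0) ⟨
    2X *ₚ P 0 +ₚ 0ₚ                ≈⟨ +ₚ-congˡ (2X *ₚ P 0) (≈-trans (*ₚ-congˡ X (wTail⊛-1 P)) (*ₚ-zeroʳ X)) ⟨
    2X *ₚ P 0 +ₚ X *ₚ (wTail ⊛ P) 1 ∎
  tail-step (suc n) = begin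
    (wTail₂ ⊛ P) (suc n)                             ≈⟨ sumₚ-suc n (λ i → wTail₂ i *ₚ P (suc n ∸ i)) ⟩
    wTail 2 *ₚ P (suc n) +ₚ (shiftₛ wTail₂ ⊛ P) n    ≈⟨ +ₚ-cong (*ₚ-congʳ (P (suc n)) wTail-2)
                                                               (⊛-factorˡ X (shiftₛ wTail₂) wTail₂ P n wTail-3+) ⟩
    2X *ₚ P (suc n) +ₚ X *ₚ (wTail₂ ⊛ P) n           ≈⟨ +ₚ-congˡ (2X *ₚ P (suc n)) (*ₚ-congˡ X
                                                         (≈-trans (⊛-suc wTail P (suc n) wTail-0) (⊛-suc wTail₁ P n wTail-1))) ⟨
    2X *ₚ P (suc n) +ₚ X *ₚ (wTail ⊛ P) (2 + n)      ∎

-- The coefficient form of (1 - z(u-1)) w = z + z²(u-1).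
w⊛-recurrence : ∀ P n → (wS ⊛ P) (2 + n) ≈ P (suc n) +ₚ X *ₚ P n +ₚ X *ₚ (wS ⊛ P) (suc n)
w⊛-recurrence P n = begin
  (wS ⊛ P) (2 + n)
    ≈⟨ w⊛-split (suc n) ⟩
  P (suc n) +ₚ (wTail ⊛ P) (2 + n)
    ≈⟨ +ₚ-congˡ (P (suc n)) (wTail⊛-2+ P n) ⟩
  P (suc n) +ₚ (2X *ₚ P n +ₚ X *ₚ T)
    ≈⟨ mk≈ (λ k → regroup (P (suc n) k) ((X *ₚ P n) k) ((X *ₚ T) k) (at (·-*ₚ-assoc (+ 2) X (P n)) k)) ⟩
  P (suc n) +ₚ X *ₚ P n +ₚ (X *ₚ P n +ₚ X *ₚ T)
    ≈⟨ +ₚ-congˡ (P (suc n) +ₚ X *ₚ P n) (*ₚ-distribˡ-+ₚ X (P n) T) ⟨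
  P (suc n) +ₚ X *ₚ P n +ₚ X *ₚ (P n +ₚ T)
    ≈⟨ +ₚ-congˡ (P (suc n) +ₚ X *ₚ P n) (*ₚ-congˡ X (w⊛-split n)) ⟨
  P (suc n) +ₚ X *ₚ P n +ₚ X *ₚ (wS ⊛ P) (suc n) ∎
  where
  open ≈-Reasoning
  T = (wTail ⊛ P) (suc n)
  w⊛-split : ∀ m → (wS ⊛ P) (suc m) ≈ P m +ₚ (wTail ⊛ P) (suc m)
  w⊛-split m = ≈-trans (⊛-distribʳ-⊕ zS wTail P (suc m))
                       (+ₚ-cong (≈-trans (monomial-⊛ zS-monomial P m) (*ₚ-identityˡ (P m))) ≈-refl)
  regroup : ∀ {c} a b t → c ≡ + 2 *ℤ b → a +ℤ (c +ℤ t) ≡ a +ℤ b +ℤ (b +ℤ t)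
  regroup a b t refl = regroup′ a b t
    where
    regroup′ : ∀ a b t → a +ℤ (+ 2 *ℤ b +ℤ t) ≡ a +ℤ b +ℤ (b +ℤ t)
    regroup′ = ℤ-Solver.solve-∀

pow-w-diagonal : ∀ m → pow wS m m ≈ 1ₚ
pow-w-diagonal m = ≈-trans (pow-diagonal wS m w-0) (≈-trans (^ₚ-cong m w-1) (1ₚ^ₚ m))

const⊛ : ∀ c f n → (const c ⊛ f) n ≈ c · f n
const⊛ c f n = begin
  (const c ⊛ f) n        ≈⟨ monomial-⊛ (const-monomial c) f n ⟩
  c · 1ₚ *ₚ f n          ≈⟨ ·-*ₚ-assoc c 1ₚ (f n) ⟩
  c · (1ₚ *ₚ f n)        ≈⟨ ·-congˡ c (*ₚ-identityˡ (f n)) ⟩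
  c · f n                ∎
  where open ≈-Reasoning

factorial-step : ∀ s f a b c A B C y → f *ℤ a ≡ A *ℤ y → f *ℤ b ≡ B *ℤ y → s *ℤ f *ℤ c ≡ C *ℤ y →
                 s *ℤ f *ℤ (a +ℤ b +ℤ c) ≡ (s *ℤ A +ℤ C +ℤ s *ℤ B) *ℤ y
factorial-step s f a b c A B C y fa≡ fb≡ sfc≡ = begin
  s *ℤ f *ℤ (a +ℤ b +ℤ c)                     ≡⟨ expand s f a b c ⟩
  s *ℤ (f *ℤ a) +ℤ s *ℤ (f *ℤ b) +ℤ s *ℤ f *ℤ c
    ≡⟨ cong₂ _+ℤ_ (cong₂ _+ℤ_ (cong (s *ℤ_) fa≡) (cong (s *ℤ_) fb≡)) sfc≡ ⟩
  s *ℤ (A *ℤ y) +ℤ s *ℤ (B *ℤ y) +ℤ C *ℤ y     ≡⟨ collect s A B C y ⟩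
  (s *ℤ A +ℤ C +ℤ s *ℤ B) *ℤ y                ∎
  where
  open ≡-Reasoning
  expand : ∀ s f a b c → s *ℤ f *ℤ (a +ℤ b +ℤ c) ≡ s *ℤ (f *ℤ a) +ℤ s *ℤ (f *ℤ b) +ℤ s *ℤ f *ℤ c
  expand = ℤ-Solver.solve-∀
  collect : ∀ s A B C y → s *ℤ (A *ℤ y) +ℤ s *ℤ (B *ℤ y) +ℤ C *ℤ y ≡ (s *ℤ A +ℤ C +ℤ s *ℤ B) *ℤ y
  collect = ℤ-Solver.solve-∀

pos-combination : ∀ s a c b → + (s * a + c + s * b) ≡ + s *ℤ + a +ℤ + c +ℤ + s *ℤ + b
pos-combination s a c b = begin
  + (s * a + c + s * b)             ≡⟨ ℤ.pos-+ (s * a + c) (s * b) ⟩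
  + (s * a + c) +ℤ + (s * b)        ≡⟨ cong₂ _+ℤ_ (trans (ℤ.pos-+ (s * a) c) (cong (_+ℤ + c) (ℤ.pos-* s a)))
                                                  (ℤ.pos-* s b) ⟩
  + s *ℤ + a +ℤ + c +ℤ + s *ℤ + b   ∎
  where open ≡-Reasoning

module _ (E : ℕ → ℕ → ℕ)
         (E-zero : ∀ N → E N 0 ≡ N !)
         (E-diagonal : ∀ N → E (suc N) (suc N) ≡ 0)
         (E-recurrence : ∀ m j → E (2 + m + j) (suc j) ≡
                                 suc m * E (suc m + j) (suc j) + E (suc m + j) j + suc m * E (m + j) j)
  where

  factorial-pow-w : ∀ m j → (+ (m !)) · pow wS m (m + j) ≈ (+ E (m + j) j) · X ^ₚ j
  factorial-pow-w m zero rewrite +-identityʳ m = mk≈ λ k →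
    trans (cong (+ (m !) *ℤ_) (at (pow-w-diagonal m) k)) (cong (λ t → + t *ℤ one 0 k) (sym (E-zero m)))
  factorial-pow-w zero (suc j) = mk≈ λ k → trans (vanish k) (cong (λ t → + t *ℤ (X ^ₚ suc j) k) (sym (E-diagonal j)))
    where
    vanish : ∀ k → + 1 *ℤ one (suc j) k ≡ + 0
    vanish zero    = refl
    vanish (suc k) = refl
  factorial-pow-w (suc m) (suc j) rewrite +-suc m j = mk≈ λ k → begin
    + (suc m !) *ℤ pow wS (suc m) (2 + N) k
      ≡⟨ cong (+ (suc m !) *ℤ_) (at (w⊛-recurrence (pow wS m) N) k) ⟩
    + (suc m !) *ℤ (w₁ k +ℤ (X *ₚ w₀) k +ℤ (X *ₚ w′₁) k)
      ≡⟨ cong (_*ℤ (w₁ k +ℤ (X *ₚ w₀) k +ℤ (X *ₚ w′₁) k)) (ℤ.pos-* (suc m) (m !)) ⟩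
    + suc m *ℤ + (m !) *ℤ (w₁ k +ℤ (X *ₚ w₀) k +ℤ (X *ₚ w′₁) k)
      ≡⟨ factorial-step (+ suc m) (+ (m !)) (w₁ k) ((X *ₚ w₀) k) ((X *ₚ w′₁) k) (+ A) (+ B) (+ C) ((X ^ₚ suc j) k)
           (at ih₁ k) (at ih₀ k) (trans (cong (_*ℤ (X *ₚ w′₁) k) (sym (ℤ.pos-* (suc m) (m !)))) (at ih′₁ k)) ⟩
    (+ suc m *ℤ + A +ℤ + C +ℤ + suc m *ℤ + B) *ℤ (X ^ₚ suc j) k
      ≡⟨ cong (_*ℤ (X ^ₚ suc j) k) (trans (cong +_ (E-recurrence m j)) (pos-combination (suc m) A C B)) ⟨
    + E (2 + N) (suc j) *ℤ (X ^ₚ suc j) k ∎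
    where
    open ≡-Reasoning
    N = m + j
    w₁ = pow wS m (suc N)
    w₀ = pow wS m N
    w′₁ = pow wS (suc m) (suc N)
    A = E (suc N) (suc j)
    B = E N j
    C = E (suc N) j
    ih₁ : (+ (m !)) · w₁ ≈ (+ A) · X ^ₚ suc j
    ih₁ = subst (λ t → (+ (m !)) · pow wS m t ≈ (+ E t (suc j)) · X ^ₚ suc j) (+-suc m j) (factorial-pow-w m (suc j))
    ih₀ : (+ (m !)) · (X *ₚ w₀) ≈ (+ B) · X ^ₚ suc j
    ih₀ = ·-*ₚ-congˡ X (+ (m !)) (+ B) (factorial-pow-w m j)
    ih′₁ : (+ (suc m !)) · (X *ₚ w′₁) ≈ (+ C) · X ^ₚ suc j
    ih′₁ = ·-*ₚ-congˡ X (+ (suc m !)) (+ C) (factorial-pow-w (suc m) j)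
  rhs-coefficient : ∀ n k → rhs n k ≡ sumTo n (λ j → + E n j *ℤ (X ^ₚ j) k)
  rhs-coefficient n k = begin
    sumTo n (λ m → (const (+ (m !)) ⊛ pow wS m) n k)
      ≡⟨ sumTo-cong n (λ m _ → at (const⊛ (+ (m !)) (pow wS m) n) k) ⟩
    sumTo n (λ m → + (m !) *ℤ pow wS m n k)
      ≡⟨ sumTo-reverse n _ ⟩
    sumTo n (λ j → + ((n ∸ j) !) *ℤ pow wS (n ∸ j) n k)
      ≡⟨ sumTo-cong n (λ j j≤n → subst (λ t → + ((n ∸ j) !) *ℤ pow wS (n ∸ j) t k ≡ + E t j *ℤ (X ^ₚ j) k)
                                        (m∸n+n≡m j≤n) (at (factorial-pow-w (n ∸ j) j) k)) ⟩
    sumTo n (λ j → + E n j *ℤ (X ^ₚ j) k) ∎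
    where open ≡-Reasoning

binom : ℕ → ℕ → ℕ
binom n       zero    = 1
binom zero    (suc k) = 0
binom (suc n) (suc k) = binom n k + binom n (suc k)

binom-< : ∀ n k → n < k → binom n k ≡ 0
binom-< zero    (suc k) _         = refl
binom-< (suc n) (suc k) (s≤s n<k) rewrite binom-< n k n<k | binom-< n (suc k) (m<n⇒m<1+n n<k) = refl

binom-1 : ∀ n → binom n 1 ≡ n
binom-1 zero    = refl
binom-1 (suc n) = cong suc (binom-1 n)

suc-*-binom : ∀ n k → suc k * binom (suc n) (suc k) ≡ suc n * binom n k
suc-*-binom zero    zero    = refl
suc-*-binom zero    (suc k) rewrite *-zeroʳ k = refl
suc-*-binom (suc n) zero    rewrite binom-1 n | +-identityʳ n | *-identityʳ n = refl
suc-*-binom (suc n) (suc k) = begin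
  suc (suc k) * (binom (suc n) (suc k) + binom (suc n) (suc (suc k)))
    ≡⟨ split (suc k) (binom (suc n) (suc k)) (binom (suc n) (suc (suc k))) ⟩
  binom (suc n) (suc k) + suc k * binom (suc n) (suc k) + suc (suc k) * binom (suc n) (suc (suc k))
    ≡⟨ cong₂ (λ x y → binom (suc n) (suc k) + x + y) (suc-*-binom n k) (suc-*-binom n (suc k)) ⟩
  binom (suc n) (suc k) + suc n * binom n k + suc n * binom n (suc k)
    ≡⟨ merge (suc n) (binom n k) (binom n (suc k)) ⟩
  suc (suc n) * (binom n k + binom n (suc k)) ∎
  where
  open ≡-Reasoning
  split : ∀ s a b → suc s * (a + b) ≡ a + s * a + suc s * b
  split = ℕ-Solver.solve-∀
  merge : ∀ s a b → a + b + s * a + s * b ≡ suc s * (a + b)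
  merge = ℕ-Solver.solve-∀

isBond-suc : ∀ x y → isBond (suc x) (suc y) ≡ isBond x y
isBond-suc x y with x ∸ y ≟ 1 | y ∸ x ≟ 1
... | yes _ | _     = refl
... | no _  | yes _ = refl
... | no _  | no _  = refl

isBond≤1 : ∀ x y → isBond x y ≤ 1
isBond≤1 zero          zero          = z≤n
isBond≤1 zero          (suc zero)    = s≤s z≤n
isBond≤1 zero          (suc (suc y)) = z≤n
isBond≤1 (suc zero)    zero          = s≤s z≤n
isBond≤1 (suc (suc x)) zero          = z≤n
isBond≤1 (suc x)       (suc y) rewrite isBond-suc x y = isBond≤1 x y

isBond-sym : ∀ x y → isBond x y ≡ isBond y x
isBond-sym zero          zero          = refl
isBond-sym zero          (suc zero)    = refl
isBond-sym zero          (suc (suc y)) = refl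
isBond-sym (suc zero)    zero          = refl
isBond-sym (suc (suc x)) zero          = refl
isBond-sym (suc x)       (suc y) rewrite isBond-suc x y | isBond-suc y x = isBond-sym x y

isBond-n-1+n : ∀ n → isBond n (suc n) ≡ 1
isBond-n-1+n zero    = refl
isBond-n-1+n (suc n) = trans (isBond-suc n (suc n)) (isBond-n-1+n n)

isBond≡1⇒adjacent : ∀ x y → isBond x y ≡ 1 → suc x ≡ y ⊎ x ≡ suc y
isBond≡1⇒adjacent zero          zero          ()
isBond≡1⇒adjacent zero          (suc zero)    _ = inj₁ refl
isBond≡1⇒adjacent zero          (suc (suc y)) ()
isBond≡1⇒adjacent (suc zero)    zero          _ = inj₂ refl
isBond≡1⇒adjacent (suc (suc x)) zero          ()
isBond≡1⇒adjacent (suc x)       (suc y) b rewrite isBond-suc x y with isBond≡1⇒adjacent x y b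
... | inj₁ 1+x≡y = inj₁ (cong suc 1+x≡y)
... | inj₂ x≡1+y = inj₂ (cong suc x≡1+y)

isBond-0-or-1 : ∀ x y → isBond x y ≡ 0 ⊎ isBond x y ≡ 1
isBond-0-or-1 x y with isBond x y | isBond≤1 x y
... | zero        | _        = inj₁ refl
... | suc zero    | _        = inj₂ refl
... | suc (suc _) | s≤s ()

isBond-far : ∀ x n → x < n → isBond x (suc n) ≡ 0
isBond-far x n x<n with isBond-0-or-1 x (suc n)
... | inj₁ b≡0 = b≡0
... | inj₂ b≡1 with isBond≡1⇒adjacent x (suc n) b≡1
...   | inj₁ 1+x≡1+n = ⊥-elim (<-irrefl (suc-injective 1+x≡1+n) x<n)
...   | inj₂ x≡2+n   = ⊥-elim (<-asym x<n (subst (n <_) (sym x≡2+n) (m<n⇒m<1+n (n<1+n n))))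

sumℕ : ∀ {A : Set} → (A → ℕ) → List A → ℕ
sumℕ f []       = 0
sumℕ f (x ∷ xs) = f x + sumℕ f xs

sumℕ-cong : ∀ {A : Set} {f g : A → ℕ} {xs} → All (λ x → f x ≡ g x) xs → sumℕ f xs ≡ sumℕ g xs
sumℕ-cong []         = refl
sumℕ-cong (eq ∷ eqs) = cong₂ _+_ eq (sumℕ-cong eqs)

sumℕ-zero : ∀ {A : Set} {f : A → ℕ} {xs} → All (λ x → f x ≡ 0) xs → sumℕ f xs ≡ 0
sumℕ-zero []          = refl
sumℕ-zero (f≡0 ∷ fs≡0) rewrite f≡0 = sumℕ-zero fs≡0

sumℕ-distrib-+ : ∀ {A : Set} (f g : A → ℕ) xs → sumℕ (λ x → f x + g x) xs ≡ sumℕ f xs + sumℕ g xs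
sumℕ-distrib-+ f g []       = refl
sumℕ-distrib-+ f g (x ∷ xs) rewrite sumℕ-distrib-+ f g xs = interchange (f x) (g x) (sumℕ f xs) (sumℕ g xs)
  where
  interchange : ∀ a b c d → a + b + (c + d) ≡ a + c + (b + d)
  interchange = ℕ-Solver.solve-∀

*-distribʳ-sumℕ : ∀ {A : Set} (f : A → ℕ) c xs → sumℕ (λ x → f x * c) xs ≡ sumℕ f xs * c
*-distribʳ-sumℕ f c []       = refl
*-distribʳ-sumℕ f c (x ∷ xs) rewrite *-distribʳ-sumℕ f c xs = sym (*-distribʳ-+ c (f x) (sumℕ f xs))

*-distribˡ-sumℕ : ∀ {A : Set} c (f : A → ℕ) xs → sumℕ (λ x → c * f x) xs ≡ c * sumℕ f xs
*-distribˡ-sumℕ c f xs = begin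
  sumℕ (λ x → c * f x) xs    ≡⟨ sumℕ-cong {xs = xs} (All.tabulate (λ {x} _ → *-comm c (f x))) ⟩
  sumℕ (λ x → f x * c) xs    ≡⟨ *-distribʳ-sumℕ f c xs ⟩
  sumℕ f xs * c              ≡⟨ *-comm (sumℕ f xs) c ⟩
  c * sumℕ f xs              ∎
  where open ≡-Reasoning

sumℕ-const : ∀ {A : Set} c (xs : List A) → sumℕ (λ _ → c) xs ≡ length xs * c
sumℕ-const c []       = refl
sumℕ-const c (x ∷ xs) = cong (_+_ c) (sumℕ-const c xs)

sumℕ-++ : ∀ {A : Set} (h : A → ℕ) xs ys → sumℕ h (xs ++ ys) ≡ sumℕ h xs + sumℕ h ys
sumℕ-++ h []       ys = refl
sumℕ-++ h (x ∷ xs) ys rewrite sumℕ-++ h xs ys = sym (+-assoc (h x) (sumℕ h xs) (sumℕ h ys))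

sumℕ-concatMap : ∀ {A B : Set} (h : B → ℕ) (f : A → List B) xs →
                 sumℕ h (concatMap f xs) ≡ sumℕ (λ x → sumℕ h (f x)) xs
sumℕ-concatMap h f []       = refl
sumℕ-concatMap h f (x ∷ xs) =
  trans (sumℕ-++ h (f x) (concatMap f xs)) (cong (_+_ (sumℕ h (f x))) (sumℕ-concatMap h f xs))

sumℕ-map : ∀ {A B : Set} (h : B → ℕ) (f : A → B) xs → sumℕ h (map f xs) ≡ sumℕ (h ∘ f) xs
sumℕ-map h f []       = refl
sumℕ-map h f (x ∷ xs) = cong (_+_ (h (f x))) (sumℕ-map h f xs)

leftBond : Maybe ℕ → ℕ → ℕ
leftBond nothing  _ = 0
leftBond (just y) z = isBond y z

withLeft : Maybe ℕ → List ℕ → List ℕ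
withLeft nothing  q = q
withLeft (just y) q = y ∷ q

bondsAfter : Maybe ℕ → List ℕ → ℕ
bondsAfter l q = bondsL (withLeft l q)

bondsAfter-∷ : ∀ l z r → bondsAfter l (z ∷ r) ≡ leftBond l z + bondsL (z ∷ r)
bondsAfter-∷ nothing  z r = refl
bondsAfter-∷ (just y) z r = refl

record Insertion : Set where
  field
    result  : List ℕ
    created : ℕ
    broken  : ℕ
open Insertion

prepend : ℕ → Insertion → Insertion
prepend z g = record g { result = z ∷ result g }

-- The insertions of v into the list p whose left neighbour is l, recording the bonds created
-- next to v and whether the two entries it separates were a bond.
insertions : ℕ → Maybe ℕ → List ℕ → List Insertion
insertions v l []      = [ record { result = [ v ] ; created = leftBond l v ; broken = 0 } ]
insertions v l (z ∷ p) =
  record { result = v ∷ z ∷ p ; created = leftBond l v + isBond v z ; broken = leftBond l z }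
  ∷ map (prepend z) (insertions v (just z) p)

sum-prepend : ∀ (f : Insertion → ℕ) z gs → (∀ g → f (prepend z g) ≡ f g) →
              sumℕ f (map (prepend z) gs) ≡ sumℕ f gs
sum-prepend f z []       _    = refl
sum-prepend f z (g ∷ gs) same = cong₂ _+_ (same g) (sum-prepend f z gs same)

bonds-insertion : ∀ v l p →
  All (λ g → bondsAfter l (result g) + broken g ≡ bondsAfter l p + created g) (insertions v l p)
bonds-insertion v nothing  []      = refl ∷ []
bonds-insertion v (just y) []      = trans (+-identityʳ (isBond y v + 0)) (+-identityʳ (isBond y v)) ∷ []
bonds-insertion v l        (z ∷ p) = first ∷ All.map⁺ (All.map later (bonds-insertion v (just z) p))
  where
  first : bondsAfter l (v ∷ z ∷ p) + leftBond l z ≡ bondsAfter l (z ∷ p) + (leftBond l v + isBond v z)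
  first rewrite bondsAfter-∷ l v (z ∷ p) | bondsAfter-∷ l z p =
    shuffle (leftBond l v) (isBond v z) (bondsL (z ∷ p)) (leftBond l z)
    where
    shuffle : ∀ a b c d → a + (b + c) + d ≡ d + c + (a + b)
    shuffle = ℕ-Solver.solve-∀
  later : ∀ {g} → bondsAfter (just z) (result g) + broken g ≡ bondsAfter (just z) p + created g →
          bondsAfter l (z ∷ result g) + broken g ≡ bondsAfter l (z ∷ p) + created g
  later {g} eq rewrite bondsAfter-∷ l z (result g) | bondsAfter-∷ l z p
                     | +-assoc (leftBond l z) (bondsL (z ∷ result g)) (broken g)
                     | +-assoc (leftBond l z) (bondsL (z ∷ p)) (created g) = cong (_+_ (leftBond l z)) eq

sum-broken : ∀ v l p → sumℕ broken (insertions v l p) ≡ bondsAfter l p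
sum-broken v nothing  []      = refl
sum-broken v (just y) []      = refl
sum-broken v l        (z ∷ p) = begin
  leftBond l z + sumℕ broken (map (prepend z) (insertions v (just z) p))
    ≡⟨ cong (_+_ (leftBond l z)) (sum-prepend broken z (insertions v (just z) p) (λ _ → refl)) ⟩
  leftBond l z + sumℕ broken (insertions v (just z) p)
    ≡⟨ cong (_+_ (leftBond l z)) (sum-broken v (just z) p) ⟩
  leftBond l z + bondsL (z ∷ p)
    ≡⟨ bondsAfter-∷ l z p ⟨
  bondsAfter l (z ∷ p) ∎
  where open ≡-Reasoning

bondsTo : ℕ → List ℕ → ℕ
bondsTo v = sumℕ (λ z → isBond z v)

sum-created : ∀ v l p → sumℕ created (insertions v l p) ≡ leftBond l v + 2 * bondsTo v p
sum-created v l []      = refl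
sum-created v l (z ∷ p) = begin
  leftBond l v + isBond v z + sumℕ created (map (prepend z) (insertions v (just z) p))
    ≡⟨ cong (_+_ (leftBond l v + isBond v z)) (sum-prepend created z (insertions v (just z) p) (λ _ → refl)) ⟩
  leftBond l v + isBond v z + sumℕ created (insertions v (just z) p)
    ≡⟨ cong (_+_ (leftBond l v + isBond v z)) (sum-created v (just z) p) ⟩
  leftBond l v + isBond v z + (isBond z v + 2 * bondsTo v p)
    ≡⟨ cong (λ t → leftBond l v + t + (isBond z v + 2 * bondsTo v p)) (isBond-sym v z) ⟩
  leftBond l v + isBond z v + (isBond z v + 2 * bondsTo v p)
    ≡⟨ collect (leftBond l v) (isBond z v) (bondsTo v p) ⟩
  leftBond l v + 2 * (isBond z v + bondsTo v p) ∎
  where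
  open ≡-Reasoning
  collect : ∀ a b c → a + b + (b + 2 * c) ≡ a + 2 * (b + c)
  collect = ℕ-Solver.solve-∀

length-insertions : ∀ v l p → length (insertions v l p) ≡ suc (length p)
length-insertions v l []      = refl
length-insertions v l (z ∷ p) =
  cong suc (trans (List.length-map (prepend z) (insertions v (just z) p)) (length-insertions v (just z) p))

createdAndBroken : ℕ → Maybe ℕ → List ℕ → ℕ
createdAndBroken v l p = sumℕ (λ g → created g * broken g) (insertions v l p)

createdAndBroken-∷ : ∀ v l z p →
  createdAndBroken v l (z ∷ p) ≡ (leftBond l v + isBond v z) * leftBond l z + createdAndBroken v (just z) p
createdAndBroken-∷ v l z p = cong (_+_ ((leftBond l v + isBond v z) * leftBond l z))
  (sum-prepend (λ g → created g * broken g) z (insertions v (just z) p) (λ _ → refl))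

createdAndBroken-unbonded : ∀ v l p → leftBond l v ≡ 0 → All (λ z → isBond z v ≡ 0) p →
                            createdAndBroken v l p ≡ 0
createdAndBroken-unbonded v l []      l≡0 _ rewrite l≡0 = refl
createdAndBroken-unbonded v l (z ∷ p) l≡0 (z≡0 ∷ p≡0)
  rewrite createdAndBroken-∷ v l z p | l≡0 | isBond-sym v z | z≡0 = createdAndBroken-unbonded v (just z) p z≡0 p≡0

-- After inserting n among smaller entries, inserting 1+n breaks a bond while creating one
-- exactly when it goes next to n, on the side of a bond of n.
createdAndBroken-insertions : ∀ n l p → All (_< n) p → leftBond l (suc n) ≡ 0 →
  All (λ g → createdAndBroken (suc n) l (result g) ≡ created g) (insertions n l p)
createdAndBroken-insertions n l [] _ l≡0 = single ∷ []
  where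
  single : createdAndBroken (suc n) l [ n ] ≡ leftBond l n
  single rewrite createdAndBroken-∷ (suc n) l n [] | l≡0 | isBond-sym (suc n) n | isBond-n-1+n n =
    simplify (leftBond l n)
    where
    simplify : ∀ x → 1 * x + (1 * 0 + 0) ≡ x
    simplify = ℕ-Solver.solve-∀
createdAndBroken-insertions n l (z ∷ p) (z<n ∷ p<n) l≡0 =
  first ∷ All.map⁺ (All.map (λ {g} → later {g}) (createdAndBroken-insertions n (just z) p p<n z-far))
  where
  z-far : isBond z (suc n) ≡ 0
  z-far = isBond-far z n z<n
  z-far′ : isBond (suc n) z ≡ 0
  z-far′ = trans (isBond-sym (suc n) z) z-far
  first : createdAndBroken (suc n) l (n ∷ z ∷ p) ≡ leftBond l n + isBond n z
  first = begin
    createdAndBroken (suc n) l (n ∷ z ∷ p)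
      ≡⟨ createdAndBroken-∷ (suc n) l n (z ∷ p) ⟩
    (leftBond l (suc n) + isBond (suc n) n) * leftBond l n + createdAndBroken (suc n) (just n) (z ∷ p)
      ≡⟨ cong (_+_ ((leftBond l (suc n) + isBond (suc n) n) * leftBond l n)) (createdAndBroken-∷ (suc n) (just n) z p) ⟩
    (leftBond l (suc n) + isBond (suc n) n) * leftBond l n
      + ((isBond n (suc n) + isBond (suc n) z) * isBond n z + createdAndBroken (suc n) (just z) p)
      ≡⟨ cong₂ (λ s t → (leftBond l (suc n) + s) * leftBond l n + ((isBond n (suc n) + isBond (suc n) z) * isBond n z + t))
               (trans (isBond-sym (suc n) n) (isBond-n-1+n n))
               (createdAndBroken-unbonded (suc n) (just z) p z-far (All.map (λ {x} x<n → isBond-far x n x<n) p<n)) ⟩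
    (leftBond l (suc n) + 1) * leftBond l n + ((isBond n (suc n) + isBond (suc n) z) * isBond n z + 0)
      ≡⟨ cong₂ (λ s t → (s + 1) * leftBond l n + ((t + isBond (suc n) z) * isBond n z + 0)) l≡0 (isBond-n-1+n n) ⟩
    1 * leftBond l n + ((1 + isBond (suc n) z) * isBond n z + 0)
      ≡⟨ cong (λ t → 1 * leftBond l n + ((1 + t) * isBond n z + 0)) z-far′ ⟩
    1 * leftBond l n + (1 * isBond n z + 0)
      ≡⟨ simplify (leftBond l n) (isBond n z) ⟩
    leftBond l n + isBond n z ∎
    where
    open ≡-Reasoning
    simplify : ∀ x y → 1 * x + ((1 + 0) * y + 0) ≡ x + y
    simplify = ℕ-Solver.solve-∀
  later : ∀ {g} → createdAndBroken (suc n) (just z) (result g) ≡ created g →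
          createdAndBroken (suc n) l (z ∷ result g) ≡ created g
  later {g} eq rewrite createdAndBroken-∷ (suc n) l z (result g) | l≡0 | z-far′ = eq

AdjacentDistinct : Maybe ℕ → List ℕ → Set
AdjacentDistinct l        []      = ⊤
AdjacentDistinct nothing  (z ∷ p) = AdjacentDistinct (just z) p
AdjacentDistinct (just y) (z ∷ p) = y ≢ z × AdjacentDistinct (just z) p

Unique⇒AdjacentDistinct : ∀ l p → Unique (withLeft l p) → AdjacentDistinct l p
Unique⇒AdjacentDistinct l        []      _                  = tt
Unique⇒AdjacentDistinct nothing  (z ∷ p) u                  = Unique⇒AdjacentDistinct (just z) p u
Unique⇒AdjacentDistinct (just y) (z ∷ p) ((y≢z ∷ _) ∷ u)    = y≢z , Unique⇒AdjacentDistinct (just z) p u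

isBond-both-sides≤1 : ∀ n y z → y < n → z < n → y ≢ z → isBond y n + isBond n z ≤ 1
isBond-both-sides≤1 n y z y<n z<n y≢z with isBond-0-or-1 y n | isBond-0-or-1 n z
... | inj₁ y≡0 | _        rewrite y≡0 = isBond≤1 n z
... | inj₂ y≡1 | inj₁ z≡0 rewrite y≡1 | z≡0 = s≤s z≤n
... | inj₂ y≡1 | inj₂ z≡1 with isBond≡1⇒adjacent y n y≡1 | isBond≡1⇒adjacent z n (trans (isBond-sym z n) z≡1)
...   | inj₂ y≡1+n | _          = ⊥-elim (<-asym y<n (subst (n <_) (sym y≡1+n) (n<1+n n)))
...   | inj₁ _     | inj₂ z≡1+n = ⊥-elim (<-asym z<n (subst (n <_) (sym z≡1+n) (n<1+n n)))
...   | inj₁ 1+y≡n | inj₁ 1+z≡n = ⊥-elim (y≢z (suc-injective (trans 1+y≡n (sym 1+z≡n))))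

created≤1 : ∀ n l p → All (_< n) (withLeft l p) → AdjacentDistinct l p →
            All (λ g → created g ≤ 1) (insertions n l p)
created≤1 n nothing  []      _                   _           = z≤n ∷ []
created≤1 n (just y) []      _                   _           = isBond≤1 y n ∷ []
created≤1 n nothing  (z ∷ p) zp<n                adj         =
  isBond≤1 n z ∷ All.map⁺ (created≤1 n (just z) p zp<n adj)
created≤1 n (just y) (z ∷ p) (y<n ∷ z<n ∷ p<n)   (y≢z , adj) =
  isBond-both-sides≤1 n y z y<n z<n y≢z ∷ All.map⁺ (created≤1 n (just z) p (z<n ∷ p<n) adj)

broken≤1 : ∀ v l p → All (λ g → broken g ≤ 1) (insertions v l p)
broken≤1 v l        []      = z≤n ∷ []
broken≤1 v nothing  (z ∷ p) = z≤n ∷ All.map⁺ (broken≤1 v (just z) p)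
broken≤1 v (just y) (z ∷ p) = isBond≤1 y z ∷ All.map⁺ (broken≤1 v (just z) p)

sum-result : ∀ (f : ℕ → ℕ) v l p → All (λ g → sumℕ f (result g) ≡ f v + sumℕ f p) (insertions v l p)
sum-result f v l []      = refl ∷ []
sum-result f v l (z ∷ p) = refl ∷ All.map⁺ (All.map (λ eq → trans (cong (_+_ (f z)) eq) (swap (f z) (f v) _))
                                                         (sum-result f v (just z) p))
  where
  swap : ∀ a b c → a + (b + c) ≡ b + (a + c)
  swap = ℕ-Solver.solve-∀

length-result : ∀ v l p → All (λ g → length (result g) ≡ suc (length p)) (insertions v l p)
length-result v l []      = refl ∷ []
length-result v l (z ∷ p) = refl ∷ All.map⁺ (All.map (cong suc) (length-result v (just z) p))

All-result : ∀ {P : ℕ → Set} v l p → P v → All P p → All (λ g → All P (result g)) (insertions v l p)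
All-result v l []      Pv _           = (Pv ∷ []) ∷ []
All-result v l (z ∷ p) Pv (Pz ∷ Pp) =
  (Pv ∷ Pz ∷ Pp) ∷ All.map⁺ (All.map (Pz ∷_) (All-result v (just z) p Pv Pp))

Unique-result : ∀ v l p → All (v ≢_) p → Unique p → All (λ g → Unique (result g)) (insertions v l p)
Unique-result v l []      _             _             = ([] ∷ []) ∷ []
Unique-result v l (z ∷ p) (v≢z ∷ v∉p) (z∉p ∷ uniq) =
  ((v≢z ∷ v∉p) ∷ z∉p ∷ uniq)
  ∷ All.map⁺ (All.zipWith (λ { (z∉ , u) → z∉ ∷ u })
                     (All-result v (just z) p (λ v≡z → v≢z (sym v≡z)) z∉p , Unique-result v (just z) p v∉p uniq))

-- Permutations of 0 … n-1, generated by inserting n-1 into the permutations of 0 … n-2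

insertionPerms : ℕ → List (List ℕ)
insertionPerms zero    = [ [] ]
insertionPerms (suc n) = concatMap (λ p → map result (insertions n nothing p)) (insertionPerms n)

IsPerm : ℕ → List ℕ → Set
IsPerm n q = All (_< n) q × Unique q × length q ≡ n

All-concatMap : ∀ {A B : Set} {P : A → Set} {Q : B → Set} (f : A → List B) →
                (∀ {x} → P x → All Q (f x)) → ∀ {xs} → All P xs → All Q (concatMap f xs)
All-concatMap f P⇒Q Pxs = All.concat⁺ (All.map⁺ (All.map P⇒Q Pxs))

<⇒≢-All : ∀ {n} p → All (_< n) p → All (n ≢_) p
<⇒≢-All p = All.map (λ x<n n≡x → <-irrefl (sym n≡x) x<n)

IsPerm-insertions : ∀ n p → IsPerm n p → All (λ g → IsPerm (suc n) (result g)) (insertions n nothing p)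
IsPerm-insertions n p (p<n , uniq , len) =
  All.zipWith (λ { (q< , (u , l)) → q< , u , trans l (cong suc len) })
    (All-result n nothing p (n<1+n n) (All.map m<n⇒m<1+n p<n) ,
     All.zip (Unique-result n nothing p (<⇒≢-All p p<n) uniq , length-result n nothing p))

insertionPerms-IsPerm : ∀ n → All (IsPerm n) (insertionPerms n)
insertionPerms-IsPerm zero    = ([] , [] , refl) ∷ []
insertionPerms-IsPerm (suc n) = All-concatMap (λ p → map result (insertions n nothing p))
  (λ {p} perm → All.map⁺ (IsPerm-insertions n p perm)) (insertionPerms-IsPerm n)

-- Splitting a sum over insertions by the values of (created, broken) ∈ {0,1}²

neither onlyCreated onlyBroken both : Insertion → ℕ
neither     g = (1 ∸ created g) * (1 ∸ broken g)
onlyCreated g = created g * (1 ∸ broken g)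
onlyBroken  g = (1 ∸ created g) * broken g
both        g = created g * broken g

Bits : Insertion → Set
Bits g = created g ≤ 1 × broken g ≤ 1

bits-cases : ∀ (P : ℕ → ℕ → Set) → P 0 0 → P 1 0 → P 0 1 → P 1 1 → ∀ g → Bits g → P (created g) (broken g)
bits-cases P p₀₀ p₁₀ p₀₁ p₁₁ g (a≤1 , b≤1) = cases (created g) (broken g) a≤1 b≤1
  where
  cases : ∀ a b → a ≤ 1 → b ≤ 1 → P a b
  cases 0             0             _       _       = p₀₀
  cases 1             0             _       _       = p₁₀
  cases 0             1             _       _       = p₀₁
  cases 1             1             _       _       = p₁₁
  cases 0             (suc (suc _)) _       (s≤s ())
  cases 1             (suc (suc _)) _       (s≤s ())
  cases (suc (suc _)) _             (s≤s ()) _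

bit-expansion : ∀ (F : ℕ → ℕ → ℕ) g → Bits g →
  F (created g) (broken g) ≡ neither g * F 0 0 + onlyCreated g * F 1 0 + onlyBroken g * F 0 1 + both g * F 1 1
bit-expansion F = bits-cases
  (λ a b → F a b ≡ (1 ∸ a) * (1 ∸ b) * F 0 0 + a * (1 ∸ b) * F 1 0 + (1 ∸ a) * b * F 0 1 + a * b * F 1 1)
  (pick₀₀ (F 0 0) (F 1 0) (F 0 1) (F 1 1)) (pick₁₀ (F 0 0) (F 1 0) (F 0 1) (F 1 1))
  (pick₀₁ (F 0 0) (F 1 0) (F 0 1) (F 1 1)) (pick₁₁ (F 0 0) (F 1 0) (F 0 1) (F 1 1))
  where
  pick₀₀ : ∀ x y z w → x ≡ 1 * 1 * x + 0 * 1 * y + 1 * 0 * z + 0 * 0 * w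
  pick₀₀ = ℕ-Solver.solve-∀
  pick₁₀ : ∀ x y z w → y ≡ 0 * 1 * x + 1 * 1 * y + 0 * 0 * z + 1 * 0 * w
  pick₁₀ = ℕ-Solver.solve-∀
  pick₀₁ : ∀ x y z w → z ≡ 1 * 0 * x + 0 * 0 * y + 1 * 1 * z + 0 * 1 * w
  pick₀₁ = ℕ-Solver.solve-∀
  pick₁₁ : ∀ x y z w → w ≡ 0 * 0 * x + 1 * 0 * y + 0 * 1 * z + 1 * 1 * w
  pick₁₁ = ℕ-Solver.solve-∀

sum-bit-expansion : ∀ (F : ℕ → ℕ → ℕ) L → All Bits L →
  sumℕ (λ g → F (created g) (broken g)) L ≡
  sumℕ neither L * F 0 0 + sumℕ onlyCreated L * F 1 0 + sumℕ onlyBroken L * F 0 1 + sumℕ both L * F 1 1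
sum-bit-expansion F L bits = begin
  sumℕ (λ g → F (created g) (broken g)) L
    ≡⟨ sumℕ-cong (All.map (λ {g} → bit-expansion F g) bits) ⟩
  sumℕ (λ g → neither g * F 0 0 + onlyCreated g * F 1 0 + onlyBroken g * F 0 1 + both g * F 1 1) L
    ≡⟨ sumℕ-distrib-+ _ _ L ⟩
  sumℕ (λ g → neither g * F 0 0 + onlyCreated g * F 1 0 + onlyBroken g * F 0 1) L + sumℕ (λ g → both g * F 1 1) L
    ≡⟨ cong₂ _+_ (trans (sumℕ-distrib-+ _ _ L) (cong₂ _+_ (sumℕ-distrib-+ _ _ L) refl)) (*-distribʳ-sumℕ both (F 1 1) L) ⟩
  sumℕ (λ g → neither g * F 0 0) L + sumℕ (λ g → onlyCreated g * F 1 0) L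
    + sumℕ (λ g → onlyBroken g * F 0 1) L + sumℕ both L * F 1 1
    ≡⟨ cong (λ t → t + sumℕ both L * F 1 1)
            (cong₂ _+_ (cong₂ _+_ (*-distribʳ-sumℕ neither (F 0 0) L) (*-distribʳ-sumℕ onlyCreated (F 1 0) L))
                       (*-distribʳ-sumℕ onlyBroken (F 0 1) L)) ⟩
  sumℕ neither L * F 0 0 + sumℕ onlyCreated L * F 1 0 + sumℕ onlyBroken L * F 0 1 + sumℕ both L * F 1 1 ∎
  where open ≡-Reasoning

count-total : ∀ L → All Bits L →
              sumℕ neither L + sumℕ onlyCreated L + sumℕ onlyBroken L + sumℕ both L ≡ length L
count-total L bits = begin
  sumℕ neither L + sumℕ onlyCreated L + sumℕ onlyBroken L + sumℕ both L
    ≡⟨ cong₂ _+_ (cong₂ _+_ (sumℕ-distrib-+ neither onlyCreated L) refl) refl ⟨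
  sumℕ (λ g → neither g + onlyCreated g) L + sumℕ onlyBroken L + sumℕ both L
    ≡⟨ cong₂ _+_ (sumℕ-distrib-+ (λ g → neither g + onlyCreated g) onlyBroken L) refl ⟨
  sumℕ (λ g → neither g + onlyCreated g + onlyBroken g) L + sumℕ both L
    ≡⟨ sumℕ-distrib-+ (λ g → neither g + onlyCreated g + onlyBroken g) both L ⟨
  sumℕ (λ g → neither g + onlyCreated g + onlyBroken g + both g) L
    ≡⟨ sumℕ-cong (All.map (λ {g} → bits-cases (λ a b → (1 ∸ a) * (1 ∸ b) + a * (1 ∸ b) + (1 ∸ a) * b + a * b ≡ 1)
                                                refl refl refl refl g) bits) ⟩
  sumℕ (λ _ → 1) L
    ≡⟨ sumℕ-const 1 L ⟩
  length L * 1
    ≡⟨ *-identityʳ (length L) ⟩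
  length L ∎
  where open ≡-Reasoning

count-created : ∀ L → All Bits L → sumℕ onlyCreated L + sumℕ both L ≡ sumℕ created L
count-created L bits = trans (sym (sumℕ-distrib-+ onlyCreated both L))
  (sumℕ-cong (All.map (λ {g} → bits-cases (λ a b → a * (1 ∸ b) + a * b ≡ a) refl refl refl refl g) bits))

count-broken : ∀ L → All Bits L → sumℕ onlyBroken L + sumℕ both L ≡ sumℕ broken L
count-broken L bits = trans (sym (sumℕ-distrib-+ onlyBroken both L))
  (sumℕ-cong (All.map (λ {g} → bits-cases (λ a b → (1 ∸ a) * b + a * b ≡ b) refl refl refl refl g) bits))

+-cancelʳ-≡′ : ∀ {x y p q} → x + q ≡ y + p → p ≡ q → x ≡ y
+-cancelʳ-≡′ {x} {y} {p} {q} x+q≡y+p p≡q = +-cancelʳ-≡ q x y (trans x+q≡y+p (cong (_+_ y) p≡q))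

binom-insertion-identity : ∀ m j b t c₀₀ c₁₀ c₀₁ → t ≤ 1 → t ≤ b →
  c₁₀ + t ≡ 2 → c₀₁ + t ≡ b → c₀₀ + c₁₀ + c₀₁ + t ≡ suc (suc (m + j)) →
  c₀₀ * binom b (suc j) + c₁₀ * binom (suc b) (suc j) + c₀₁ * binom (b ∸ 1) (suc j) + t * binom b (suc j)
    ≡ suc m * binom b (suc j) + binom b j + binom (b ∸ t) j
binom-insertion-identity m j zero zero c₀₀ c₁₀ c₀₁ _ _ c₁₀≡ c₀₁≡ _
  rewrite +-identityʳ c₁₀ | +-identityʳ c₀₁ | c₁₀≡ | c₀₁≡ = arith c₀₀ (binom 0 j) m
  where
  arith : ∀ c x m → c * 0 + 2 * (x + 0) + 0 * 0 + 0 * 0 ≡ suc m * 0 + x + x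
  arith = ℕ-Solver.solve-∀
binom-insertion-identity m j (suc b) zero c₀₀ c₁₀ c₀₁ _ _ c₁₀≡ c₀₁≡ total
  rewrite +-identityʳ c₁₀ | +-identityʳ c₀₁ | c₁₀≡ | c₀₁≡ =
  +-cancelʳ-≡′ (arith c₀₀ d e f m j b) (cong₂ _+_ (cong (_* (d + e)) total) (suc-*-binom b j))
  where
  d = binom b j
  e = binom b (suc j)
  f = binom (suc b) j
  arith : ∀ c₀₀ d e f m j b →
    c₀₀ * (d + e) + 2 * (f + (d + e)) + suc b * e + 0 * (d + e) + (suc (suc (m + j)) * (d + e) + suc b * d)
      ≡ suc m * (d + e) + f + f + ((c₀₀ + 2 + suc b + 0) * (d + e) + suc j * (d + e))
  arith = ℕ-Solver.solve-∀
binom-insertion-identity m j zero    (suc zero) c₀₀ c₁₀ c₀₁ _ () _ _ _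
binom-insertion-identity m j (suc b) (suc zero) c₀₀ c₁₀ c₀₁ _ _ c₁₀+1≡2 c₀₁+1≡1+b total =
  subst₂ (λ x y → c₀₀ * (d + e) + x * (f + (d + e)) + y * e + 1 * (d + e) ≡ suc m * (d + e) + f + d)
         (sym c₁₀≡1) (sym c₀₁≡b)
         (+-cancelʳ-≡′ (arith c₀₀ d e f m j b) (cong₂ _+_ (cong (_* (d + e)) total′) (suc-*-binom b j)))
  where
  d = binom b j
  e = binom b (suc j)
  f = binom (suc b) j
  c₁₀≡1 : c₁₀ ≡ 1
  c₁₀≡1 = +-cancelʳ-≡ 1 c₁₀ 1 c₁₀+1≡2
  c₀₁≡b : c₀₁ ≡ b
  c₀₁≡b = +-cancelʳ-≡ 1 c₀₁ b (trans c₀₁+1≡1+b (+-comm 1 b))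
  total′ : c₀₀ + 1 + b + 1 ≡ suc (suc (m + j))
  total′ = subst₂ (λ x y → c₀₀ + x + y + 1 ≡ suc (suc (m + j))) c₁₀≡1 c₀₁≡b total
  arith : ∀ c₀₀ d e f m j b →
    c₀₀ * (d + e) + 1 * (f + (d + e)) + b * e + 1 * (d + e) + (suc (suc (m + j)) * (d + e) + suc b * d)
      ≡ suc m * (d + e) + f + d + ((c₀₀ + 1 + b + 1) * (d + e) + suc j * (d + e))
  arith = ℕ-Solver.solve-∀
binom-insertion-identity m j b (suc (suc _)) _ _ _ (s≤s ()) _ _ _ _

binom-absorption-identity : ∀ m j b c → c + b ≡ suc (m + j) →
                            c * binom b j + b * binom (b ∸ 1) j ≡ suc m * binom b j
binom-absorption-identity m zero b c c+b≡ = begin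
  c * 1 + b * 1     ≡⟨ cong₂ _+_ (*-identityʳ c) (*-identityʳ b) ⟩
  c + b             ≡⟨ c+b≡ ⟩
  suc (m + 0)       ≡⟨ cong suc (+-identityʳ m) ⟩
  suc m             ≡⟨ *-identityʳ (suc m) ⟨
  suc m * 1         ∎
  where open ≡-Reasoning
binom-absorption-identity m (suc j) zero    c _ = arith c m
  where
  arith : ∀ c m → c * 0 + 0 * 0 ≡ suc m * 0
  arith = ℕ-Solver.solve-∀
binom-absorption-identity m (suc j) (suc b) c c+b≡ =
  +-cancelʳ-≡′ (arith c d e m j b) (cong₂ _+_ (cong (_* (d + e)) c+b≡) (suc-*-binom b j))
  where
  d = binom b j
  e = binom b (suc j)
  arith : ∀ c d e m j b → c * (d + e) + suc b * e + (suc (m + suc j) * (d + e) + suc b * d)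
                          ≡ suc m * (d + e) + ((c + suc b) * (d + e) + suc j * (d + e))
  arith = ℕ-Solver.solve-∀

-- The number of permutations of 0 … N-1 with j of their bonds marked.
markedBonds : ℕ → ℕ → ℕ
markedBonds N j = sumℕ (λ q → binom (bondsL q) j) (insertionPerms N)

sumℕ-insertionPerms : ∀ n (h : List ℕ → ℕ) →
  sumℕ h (insertionPerms (suc n)) ≡ sumℕ (λ p → sumℕ (h ∘ result) (insertions n nothing p)) (insertionPerms n)
sumℕ-insertionPerms n h =
  trans (sumℕ-concatMap h (λ p → map result (insertions n nothing p)) (insertionPerms n))
        (sumℕ-cong {xs = insertionPerms n} (All.tabulate (λ {p} _ → sumℕ-map h result (insertions n nothing p))))

Bits-insertions : ∀ n p → IsPerm n p → All Bits (insertions n nothing p)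
Bits-insertions n p (p<n , uniq , _) =
  All.zip (created≤1 n nothing p p<n (Unique⇒AdjacentDistinct nothing p uniq) , broken≤1 n nothing p)

-- In a permutation of 0 … n, the entry 1+n can only bond with n, which occurs exactly once.
record TopInsertionFacts (n : ℕ) (q : List ℕ) : Set where
  field
    createdAndBroken≤1 : createdAndBroken (suc n) nothing q ≤ 1
    sum-created≡2      : sumℕ created (insertions (suc n) nothing q) ≡ 2

TopInsertionFacts-insertions : ∀ n p → IsPerm n p → All (λ g → TopInsertionFacts n (result g)) (insertions n nothing p)
TopInsertionFacts-insertions n p (p<n , uniq , _) = All.zipWith (λ {g} → facts {g})
  (All.zip (createdAndBroken-insertions n nothing p p<n refl ,
            created≤1 n nothing p p<n (Unique⇒AdjacentDistinct nothing p uniq)) ,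
   sum-result (λ z → isBond z (suc n)) n nothing p)
  where
  bondsTo-p : bondsTo (suc n) p ≡ 0
  bondsTo-p = sumℕ-zero (All.map (λ {x} x<n → isBond-far x n x<n) p<n)
  facts : ∀ {g} → (createdAndBroken (suc n) nothing (result g) ≡ created g × created g ≤ 1) ×
                  (bondsTo (suc n) (result g) ≡ isBond n (suc n) + bondsTo (suc n) p) → TopInsertionFacts n (result g)
  facts {g} ((cb≡ , c≤1) , bondsTo≡) = record
    { createdAndBroken≤1 = subst (_≤ 1) (sym cb≡) c≤1
    ; sum-created≡2      = trans (sum-created (suc n) nothing (result g))
                                 (cong (2 *_) (trans bondsTo≡ (cong₂ _+_ (isBond-n-1+n n) bondsTo-p))) }

insertionPerms-TopInsertionFacts : ∀ n → All (TopInsertionFacts n) (insertionPerms (suc n))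
insertionPerms-TopInsertionFacts n = All-concatMap (λ p → map result (insertions n nothing p))
  (λ {p} perm → All.map⁺ (TopInsertionFacts-insertions n p perm)) (insertionPerms-IsPerm n)

m+n≡o+p⇒m≡p+o∸n : ∀ m n o p → m + n ≡ o + p → m ≡ p + o ∸ n
m+n≡o+p⇒m≡p+o∸n m n o p m+n≡o+p = begin
  m              ≡⟨ m+n∸n≡m m n ⟨
  m + n ∸ n      ≡⟨ cong (_∸ n) (trans m+n≡o+p (+-comm o p)) ⟩
  p + o ∸ n      ∎
  where open ≡-Reasoning

m+n≡o+p⇒m∸p≡o∸n : ∀ m n o p → m + n ≡ o + p → m ∸ p ≡ o ∸ n
m+n≡o+p⇒m∸p≡o∸n m n o p m+n≡o+p = begin
  m ∸ p                ≡⟨ cong (_∸ p) (m+n≡o+p⇒m≡p+o∸n m n o p m+n≡o+p) ⟩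
  p + o ∸ n ∸ p        ≡⟨ ∸-+-assoc (p + o) n p ⟩
  p + o ∸ (n + p)      ≡⟨ cong (_∸_ (p + o)) (+-comm n p) ⟩
  p + o ∸ (p + n)      ≡⟨ [m+n]∸[m+o]≡n∸o p o n ⟩
  o ∸ n                ∎
  where open ≡-Reasoning

sum-binom-top-insertions : ∀ m j q → IsPerm (suc (m + j)) q → TopInsertionFacts (m + j) q →
  sumℕ (λ g → binom (bondsL (result g)) (suc j)) (insertions (suc (m + j)) nothing q)
    ≡ suc m * binom (bondsL q) (suc j) + binom (bondsL q) j + binom (bondsL q ∸ createdAndBroken (suc (m + j)) nothing q) j
sum-binom-top-insertions m j q perm facts = begin
  sumℕ (λ g → binom (bondsL (result g)) (suc j)) L
    ≡⟨ sumℕ-cong (All.map (λ {g} eq → cong (λ x → binom x (suc j))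
                                           (m+n≡o+p⇒m≡p+o∸n (bondsL (result g)) (broken g) b (created g) eq))
                         (bonds-insertion N nothing q)) ⟩
  sumℕ (λ g → binom (created g + b ∸ broken g) (suc j)) L
    ≡⟨ sum-bit-expansion (λ a β → binom (a + b ∸ β) (suc j)) L bits ⟩
  c₀₀ * binom b (suc j) + c₁₀ * binom (suc b) (suc j) + c₀₁ * binom (b ∸ 1) (suc j) + t * binom b (suc j)
    ≡⟨ binom-insertion-identity m j b t c₀₀ c₁₀ c₀₁ (createdAndBroken≤1 facts) t≤b c₁₀+t≡2 c₀₁+t≡b total ⟩
  suc m * binom b (suc j) + binom b j + binom (b ∸ t) j ∎
  where
  open ≡-Reasoning
  open TopInsertionFacts
  N = suc (m + j)
  L = insertions N nothing q
  b = bondsL q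
  t = createdAndBroken N nothing q
  c₀₀ = sumℕ neither L
  c₁₀ = sumℕ onlyCreated L
  c₀₁ = sumℕ onlyBroken L
  bits = Bits-insertions N q perm
  c₀₁+t≡b : c₀₁ + t ≡ b
  c₀₁+t≡b = trans (count-broken L bits) (sum-broken N nothing q)
  t≤b : t ≤ b
  t≤b = subst (t ≤_) c₀₁+t≡b (m≤n+m t c₀₁)
  c₁₀+t≡2 : c₁₀ + t ≡ 2
  c₁₀+t≡2 = trans (count-created L bits) (sum-created≡2 facts)
  total : c₀₀ + c₁₀ + c₀₁ + t ≡ suc (suc (m + j))
  total = trans (count-total L bits) (trans (length-insertions N nothing q) (cong suc (proj₂ (proj₂ perm))))

sum-binom-bonds∸createdAndBroken : ∀ m j p → IsPerm (m + j) p →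
  sumℕ (λ g → binom (bondsL (result g) ∸ createdAndBroken (suc (m + j)) nothing (result g)) j) (insertions (m + j) nothing p)
    ≡ suc m * binom (bondsL p) j
sum-binom-bonds∸createdAndBroken m j p perm@(p<n , _ , len) = begin
  sumℕ (λ g → binom (bondsL (result g) ∸ createdAndBroken (suc n) nothing (result g)) j) L
    ≡⟨ sumℕ-cong (All.zipWith (λ {g} (cb≡ , eq) → cong (λ x → binom x j) (reduced-bonds g cb≡ eq))
                  (createdAndBroken-insertions n nothing p p<n refl , bonds-insertion n nothing p)) ⟩
  sumℕ (λ g → binom (b ∸ broken g) j) L
    ≡⟨ sum-bit-expansion (λ _ β → binom (b ∸ β) j) L bits ⟩
  c₀₀ * binom b j + c₁₀ * binom b j + c₀₁ * binom (b ∸ 1) j + c₁₁ * binom (b ∸ 1) j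
    ≡⟨ regroup c₀₀ c₁₀ c₀₁ c₁₁ (binom b j) (binom (b ∸ 1) j) ⟩
  (c₀₀ + c₁₀) * binom b j + (c₀₁ + c₁₁) * binom (b ∸ 1) j
    ≡⟨ cong (λ t → (c₀₀ + c₁₀) * binom b j + t * binom (b ∸ 1) j) c₀₁+c₁₁≡b ⟩
  (c₀₀ + c₁₀) * binom b j + b * binom (b ∸ 1) j
    ≡⟨ binom-absorption-identity m j b (c₀₀ + c₁₀) unbroken+b≡ ⟩
  suc m * binom b j ∎
  where
  open ≡-Reasoning
  n = m + j
  L = insertions n nothing p
  b = bondsL p
  c₀₀ = sumℕ neither L
  c₁₀ = sumℕ onlyCreated L
  c₀₁ = sumℕ onlyBroken L
  c₁₁ = sumℕ both L
  bits = Bits-insertions n p perm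
  reduced-bonds : ∀ g → createdAndBroken (suc n) nothing (result g) ≡ created g →
                  bondsL (result g) + broken g ≡ b + created g →
                  bondsL (result g) ∸ createdAndBroken (suc n) nothing (result g) ≡ b ∸ broken g
  reduced-bonds g cb≡ eq = trans (cong (_∸_ (bondsL (result g))) cb≡) (m+n≡o+p⇒m∸p≡o∸n _ (broken g) b (created g) eq)
  regroup : ∀ a b c d x y → a * x + b * x + c * y + d * y ≡ (a + b) * x + (c + d) * y
  regroup = ℕ-Solver.solve-∀
  c₀₁+c₁₁≡b : c₀₁ + c₁₁ ≡ b
  c₀₁+c₁₁≡b = trans (count-broken L bits) (sum-broken n nothing p)
  unbroken+b≡ : c₀₀ + c₁₀ + b ≡ suc (m + j)
  unbroken+b≡ = begin
    c₀₀ + c₁₀ + b                 ≡⟨ cong (_+_ (c₀₀ + c₁₀)) c₀₁+c₁₁≡b ⟨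
    c₀₀ + c₁₀ + (c₀₁ + c₁₁)       ≡⟨ +-assoc (c₀₀ + c₁₀) c₀₁ c₁₁ ⟨
    c₀₀ + c₁₀ + c₀₁ + c₁₁         ≡⟨ count-total L bits ⟩
    length L                      ≡⟨ length-insertions n nothing p ⟩
    suc (length p)                ≡⟨ cong suc len ⟩
    suc (m + j)                   ∎

markedBonds-recurrence : ∀ m j → markedBonds (2 + m + j) (suc j) ≡
  suc m * markedBonds (suc m + j) (suc j) + markedBonds (suc m + j) j + suc m * markedBonds (m + j) j
markedBonds-recurrence m j = begin
  markedBonds (suc N) (suc j)
    ≡⟨ sumℕ-insertionPerms N (λ q → binom (bondsL q) (suc j)) ⟩
  sumℕ (λ q → sumℕ (λ g → binom (bondsL (result g)) (suc j)) (insertions N nothing q)) (insertionPerms N)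
    ≡⟨ sumℕ-cong (All.zipWith (λ {q} (perm , facts) → sum-binom-top-insertions m j q perm facts)
                               (insertionPerms-IsPerm N , insertionPerms-TopInsertionFacts (m + j))) ⟩
  sumℕ (λ q → suc m * binom (bondsL q) (suc j) + binom (bondsL q) j + reduced q) (insertionPerms N)
    ≡⟨ sumℕ-distrib-+ _ reduced (insertionPerms N) ⟩
  sumℕ (λ q → suc m * binom (bondsL q) (suc j) + binom (bondsL q) j) (insertionPerms N) + Σreduced
    ≡⟨ cong (_+ Σreduced) (sumℕ-distrib-+ _ _ (insertionPerms N)) ⟩
  sumℕ (λ q → suc m * binom (bondsL q) (suc j)) (insertionPerms N) + markedBonds N j + Σreduced
    ≡⟨ cong₂ (λ x y → x + markedBonds N j + y)
             (*-distribˡ-sumℕ (suc m) (λ q → binom (bondsL q) (suc j)) (insertionPerms N)) Σreduced≡ ⟩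
  suc m * markedBonds N (suc j) + markedBonds N j + suc m * markedBonds (m + j) j ∎
  where
  open ≡-Reasoning
  N = suc (m + j)
  reduced : List ℕ → ℕ
  reduced q = binom (bondsL q ∸ createdAndBroken N nothing q) j
  Σreduced = sumℕ reduced (insertionPerms N)
  Σreduced≡ : Σreduced ≡ suc m * markedBonds (m + j) j
  Σreduced≡ = begin
    Σreduced
      ≡⟨ sumℕ-insertionPerms (m + j) reduced ⟩
    sumℕ (λ p → sumℕ (reduced ∘ result) (insertions (m + j) nothing p)) (insertionPerms (m + j))
      ≡⟨ sumℕ-cong (All.map (λ {p} → sum-binom-bonds∸createdAndBroken m j p) (insertionPerms-IsPerm (m + j))) ⟩
    sumℕ (λ p → suc m * binom (bondsL p) j) (insertionPerms (m + j))
      ≡⟨ *-distribˡ-sumℕ (suc m) (λ p → binom (bondsL p) j) (insertionPerms (m + j)) ⟩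
    suc m * markedBonds (m + j) j ∎

markedBonds-zero : ∀ N → markedBonds N 0 ≡ N !
markedBonds-zero zero    = refl
markedBonds-zero (suc n) = begin
  markedBonds (suc n) 0
    ≡⟨ sumℕ-insertionPerms n (λ _ → 1) ⟩
  sumℕ (λ p → sumℕ (λ _ → 1) (insertions n nothing p)) (insertionPerms n)
    ≡⟨ sumℕ-cong (All.map (λ {p} (_ , _ , len) → trans (sumℕ-const 1 (insertions n nothing p))
                            (trans (*-identityʳ _) (trans (length-insertions n nothing p) (cong suc len))))
                          (insertionPerms-IsPerm n)) ⟩
  sumℕ (λ _ → suc n) (insertionPerms n)
    ≡⟨ sumℕ-const (suc n) (insertionPerms n) ⟩
  length (insertionPerms n) * suc n
    ≡⟨ cong (_* suc n) length≡n! ⟩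
  n ! * suc n
    ≡⟨ *-comm (n !) (suc n) ⟩
  suc n ! ∎
  where
  open ≡-Reasoning
  length≡n! : length (insertionPerms n) ≡ n !
  length≡n! = begin
    length (insertionPerms n)             ≡⟨ *-identityʳ _ ⟨
    length (insertionPerms n) * 1         ≡⟨ sumℕ-const 1 (insertionPerms n) ⟨
    markedBonds n 0                       ≡⟨ markedBonds-zero n ⟩
    n !                                   ∎

bondsL-∷≤length : ∀ z r → bondsL (z ∷ r) ≤ length r
bondsL-∷≤length z []      = z≤n
bondsL-∷≤length z (y ∷ r) = +-mono-≤ (isBond≤1 z y) (bondsL-∷≤length y r)

bondsL≤length : ∀ q → bondsL q ≤ length q
bondsL≤length []      = z≤n
bondsL≤length (z ∷ r) = m≤n⇒m≤1+n (bondsL-∷≤length z r)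

markedBonds-diagonal : ∀ N → markedBonds (suc N) (suc N) ≡ 0
markedBonds-diagonal N = sumℕ-zero (All.map (λ {q} perm → binom-< (bondsL q) (suc N) (bonds<1+N q perm))
                                            (insertionPerms-IsPerm (suc N)))
  where
  bonds<1+N : ∀ q → IsPerm (suc N) q → bondsL q < suc N
  bonds<1+N (z ∷ r) (_ , _ , len) = s≤s (subst (bondsL (z ∷ r) ≤_) (suc-injective len) (bondsL-∷≤length z r))

U : Poly
U = uS 0

U≈1+X : U ≈ 1ₚ +ₚ X
U≈1+X = mk≈ λ k → rearrange (uS 0 k) (one 0 k)
  where
  rearrange : ∀ a c → a ≡ c +ℤ (a +ℤ - c)
  rearrange = ℤ-Solver.solve-∀

binomial-theorem : ∀ b N → b ≤ N → sumₚ N (λ j → (+ binom b j) · X ^ₚ j) ≈ U ^ₚ b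
binomial-theorem zero    N       _ = mk≈ λ k →
  trans (sumTo-single N 0 z≤n (λ { zero _ j≢0 → ⊥-elim (j≢0 refl) ; (suc j) _ _ → refl }))
        (ℤ.*-identityˡ (one 0 k))
binomial-theorem (suc b) (suc N) (s≤s b≤N) = ≈-sym (begin
  U *ₚ U ^ₚ b
    ≈⟨ *ₚ-cong U≈1+X (≈-sym (binomial-theorem b (suc N) (m≤n⇒m≤1+n b≤N))) ⟩
  (1ₚ +ₚ X) *ₚ S
    ≈⟨ *ₚ-distribʳ-+ₚ S 1ₚ X ⟩
  1ₚ *ₚ S +ₚ X *ₚ S
    ≈⟨ +ₚ-cong (*ₚ-identityˡ S) (*ₚ-distribˡ-sumₚ (suc N) X term) ⟩
  S +ₚ sumₚ (suc N) (λ j → X *ₚ term j)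
    ≈⟨ +ₚ-cong (sumₚ-suc N term) (sumₚ-cong (suc N) (λ j _ → *ₚ-·-comm (+ binom b j) X (X ^ₚ j))) ⟩
  term 0 +ₚ sumₚ N (λ j → term (suc j)) +ₚ sumₚ (suc N) shifted
    ≈⟨ +ₚ-congˡ (term 0 +ₚ sumₚ N (λ j → term (suc j))) (mk≈ λ k → drop-last k) ⟩
  term 0 +ₚ sumₚ N (λ j → term (suc j)) +ₚ sumₚ N shifted
    ≈⟨ mk≈ (λ k → ℤ.+-assoc (term 0 k) _ _) ⟩
  term 0 +ₚ (sumₚ N (λ j → term (suc j)) +ₚ sumₚ N shifted)
    ≈⟨ +ₚ-congˡ (term 0) (sumₚ-distrib-+ₚ N (λ j → term (suc j)) shifted) ⟨
  term 0 +ₚ sumₚ N (λ j → (+ binom b (suc j)) · X ^ₚ suc j +ₚ (+ binom b j) · X ^ₚ suc j)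
    ≈⟨ +ₚ-congˡ (term 0) (sumₚ-cong N (λ j _ → pascal j)) ⟩
  term 0 +ₚ sumₚ N (λ j → (+ binom (suc b) (suc j)) · X ^ₚ suc j)
    ≈⟨ sumₚ-suc N (λ j → (+ binom (suc b) j) · X ^ₚ j) ⟨
  sumₚ (suc N) (λ j → (+ binom (suc b) j) · X ^ₚ j) ∎)
  where
  open ≈-Reasoning
  term : ℕ → Poly
  term j = (+ binom b j) · X ^ₚ j
  S = sumₚ (suc N) term
  shifted : ℕ → Poly
  shifted j = (+ binom b j) · X ^ₚ suc j
  drop-last : ∀ k → sumₚ (suc N) shifted k ≡ sumₚ N shifted k
  drop-last k = trans
    (cong (λ t → sumTo N (λ j → shifted j k) +ℤ + t *ℤ (X ^ₚ suc (suc N)) k) (binom-< b (suc N) (s≤s b≤N)))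
    (ℤ.+-identityʳ (sumTo N (λ j → shifted j k)))
  pascal : ∀ j → (+ binom b (suc j)) · X ^ₚ suc j +ₚ (+ binom b j) · X ^ₚ suc j ≈ (+ binom (suc b) (suc j)) · X ^ₚ suc j
  pascal j = begin
    (+ binom b (suc j)) · X ^ₚ suc j +ₚ (+ binom b j) · X ^ₚ suc j
      ≈⟨ ·-distribʳ-+ℤ (+ binom b (suc j)) (+ binom b j) (X ^ₚ suc j) ⟨
    (+ binom b (suc j) +ℤ + binom b j) · X ^ₚ suc j
      ≈⟨ mk≈ (λ k → cong (_*ℤ (X ^ₚ suc j) k) (trans (ℤ.+-comm (+ binom b (suc j)) (+ binom b j))
                                                      (sym (ℤ.pos-+ (binom b j) (binom b (suc j)))))) ⟩
    (+ binom (suc b) (suc j)) · X ^ₚ suc j ∎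

δ : ℕ → ℕ → ℕ
δ zero    zero    = 1
δ zero    (suc k) = 0
δ (suc b) zero    = 0
δ (suc b) (suc k) = δ b k

δ-refl : ∀ b → δ b b ≡ 1
δ-refl zero    = refl
δ-refl (suc b) = δ-refl b

δ-≢ : ∀ b k → b ≢ k → δ b k ≡ 0
δ-≢ zero    zero    b≢k = ⊥-elim (b≢k refl)
δ-≢ zero    (suc k) _   = refl
δ-≢ (suc b) zero    _   = refl
δ-≢ (suc b) (suc k) b≢k = δ-≢ b k (λ b≡k → b≢k (cong suc b≡k))

U^ₚ-coeff : ∀ b k → (U ^ₚ b) k ≡ + δ b k
U^ₚ-coeff zero    zero    = refl
U^ₚ-coeff zero    (suc k) = refl
U^ₚ-coeff (suc b) zero    = refl
U^ₚ-coeff (suc b) (suc k) = trans (U-shift (U ^ₚ b) k) (U^ₚ-coeff b k)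
  where
  U-shift : ∀ f k → (U *ₚ f) (suc k) ≡ f k
  U-shift f k = trans (sumTo-single (suc k) 1 (s≤s z≤n) vanish) (ℤ.*-identityˡ (f k))
    where
    vanish : ∀ i → i ≤ suc k → i ≢ 1 → uS 0 i *ℤ f (suc k ∸ i) ≡ + 0
    vanish zero          _ _   = refl
    vanish (suc zero)    _ i≢1 = ⊥-elim (i≢1 refl)
    vanish (suc (suc i)) _ _   = refl

sumℤ : ∀ {A : Set} → (A → ℤ) → List A → ℤ
sumℤ f []       = + 0
sumℤ f (x ∷ xs) = f x +ℤ sumℤ f xs

pos-sumℕ : ∀ {A : Set} (f : A → ℕ) xs → + sumℕ f xs ≡ sumℤ (λ x → + f x) xs
pos-sumℕ f []       = refl
pos-sumℕ f (x ∷ xs) = trans (ℤ.pos-+ (f x) (sumℕ f xs)) (cong (_+ℤ_ (+ f x)) (pos-sumℕ f xs))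

*-distribʳ-sumℤ : ∀ {A : Set} (f : A → ℤ) c xs → sumℤ f xs *ℤ c ≡ sumℤ (λ x → f x *ℤ c) xs
*-distribʳ-sumℤ f c []       = refl
*-distribʳ-sumℤ f c (x ∷ xs) = trans (ℤ.*-distribʳ-+ c (f x) (sumℤ f xs)) (cong (_+ℤ_ (f x *ℤ c)) (*-distribʳ-sumℤ f c xs))

sumTo-sumℤ : ∀ {A : Set} n (g : A → ℕ → ℤ) xs →
             sumTo n (λ j → sumℤ (λ x → g x j) xs) ≡ sumℤ (λ x → sumTo n (g x)) xs
sumTo-sumℤ n g []       = sumTo-zero n (λ _ _ → refl)
sumTo-sumℤ n g (x ∷ xs) = trans (sumTo-distrib-+ n (g x) (λ j → sumℤ (λ x → g x j) xs))
                                (cong (_+ℤ_ (sumTo n (g x))) (sumTo-sumℤ n g xs))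

sumℤ-cong : ∀ {A : Set} {f g : A → ℤ} {xs} → All (λ x → f x ≡ g x) xs → sumℤ f xs ≡ sumℤ g xs
sumℤ-cong []         = refl
sumℤ-cong (eq ∷ eqs) = cong₂ _+ℤ_ eq (sumℤ-cong eqs)

length-filter : ∀ {A : Set} (f : A → ℕ) k xs → length (filter (λ x → f x ≟ k) xs) ≡ sumℕ (λ x → δ (f x) k) xs
length-filter f k []       = refl
length-filter f k (x ∷ xs) with f x ≟ k
... | yes fx≡k = begin
  length (filter (λ x → f x ≟ k) (x ∷ xs))      ≡⟨ cong length (List.filter-accept (λ x → f x ≟ k) fx≡k) ⟩
  suc (length (filter (λ x → f x ≟ k) xs))      ≡⟨ cong₂ _+_ (sym (trans (cong (λ t → δ t k) fx≡k) (δ-refl k)))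
                                                            (length-filter f k xs) ⟩
  δ (f x) k + sumℕ (λ x → δ (f x) k) xs         ∎
  where open ≡-Reasoning
... | no  fx≢k = begin
  length (filter (λ x → f x ≟ k) (x ∷ xs))      ≡⟨ cong length (List.filter-reject (λ x → f x ≟ k) fx≢k) ⟩
  length (filter (λ x → f x ≟ k) xs)            ≡⟨ length-filter f k xs ⟩
  sumℕ (λ x → δ (f x) k) xs                     ≡⟨ cong (_+ sumℕ (λ x → δ (f x) k) xs) (δ-≢ (f x) k fx≢k) ⟨
  δ (f x) k + sumℕ (λ x → δ (f x) k) xs         ∎
  where open ≡-Reasoning

rhs≡count : ∀ n k → rhs n k ≡ + length (filter (λ q → bondsL q ≟ k) (insertionPerms n))
rhs≡count n k = begin
  rhs n k
    ≡⟨ rhs-coefficient markedBonds markedBonds-zero markedBonds-diagonal markedBonds-recurrence n k ⟩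
  sumTo n (λ j → + markedBonds n j *ℤ (X ^ₚ j) k)
    ≡⟨ sumTo-cong n (λ j _ → trans (cong (_*ℤ (X ^ₚ j) k) (pos-sumℕ (λ q → binom (bondsL q) j) Pₙ))
                                   (*-distribʳ-sumℤ _ ((X ^ₚ j) k) Pₙ)) ⟩
  sumTo n (λ j → sumℤ (λ q → + binom (bondsL q) j *ℤ (X ^ₚ j) k) Pₙ)
    ≡⟨ sumTo-sumℤ n (λ q j → + binom (bondsL q) j *ℤ (X ^ₚ j) k) Pₙ ⟩
  sumℤ (λ q → sumₚ n (λ j → (+ binom (bondsL q) j) · X ^ₚ j) k) Pₙ
    ≡⟨ sumℤ-cong (All.map (λ {q} perm → trans (at (binomial-theorem (bondsL q) n (bonds≤n q perm)) k)
                                              (U^ₚ-coeff (bondsL q) k))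
                          (insertionPerms-IsPerm n)) ⟩
  sumℤ (λ q → + δ (bondsL q) k) Pₙ
    ≡⟨ pos-sumℕ (λ q → δ (bondsL q) k) Pₙ ⟨
  + sumℕ (λ q → δ (bondsL q) k) Pₙ
    ≡⟨ cong +_ (length-filter bondsL k Pₙ) ⟨
  + length (filter (λ q → bondsL q ≟ k) Pₙ) ∎
  where
  open ≡-Reasoning
  Pₙ = insertionPerms n
  bonds≤n : ∀ q → IsPerm n q → bondsL q ≤ n
  bonds≤n q (_ , _ , len) = subst (bondsL q ≤_) len (bondsL≤length q)

Unique-concatMap : ∀ {A B : Set} (f : A → List B) {xs} → Unique xs → (∀ {x} → x ∈ xs → Unique (f x)) →
  (∀ {x x′ y} → x ∈ xs → x′ ∈ xs → y ∈ f x → y ∈ f x′ → x ≡ x′) → Unique (concatMap f xs)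
Unique-concatMap f {[]}     _           _      _        = []
Unique-concatMap f {x ∷ xs} (x∉xs ∷ u) uniq-f disjoint =
  Unique.++⁺ (uniq-f (here refl))
             (Unique-concatMap f u (λ x∈ → uniq-f (there x∈)) (λ x∈ x′∈ → disjoint (there x∈) (there x′∈)))
             (λ (y∈fx , y∈rest) → apart y∈fx y∈rest)
  where
  apart : ∀ {y} → y ∈ f x → y ∈ concatMap f xs → ⊥
  apart y∈fx y∈rest with find (∈-concatMap⁻ f y∈rest)
  ... | x′ , x′∈xs , y∈fx′ = All.lookup x∉xs x′∈xs (disjoint (here refl) (there x′∈xs) y∈fx y∈fx′)

∈-concatMap⁺′ : ∀ {A B : Set} (f : A → List B) {x y xs} → y ∈ f x → x ∈ xs → y ∈ concatMap f xs
∈-concatMap⁺′ f y∈fx x∈xs = ∈-concatMap⁺ f (Any.map (λ x≡x′ → subst (λ t → _ ∈ f t) x≡x′ y∈fx) x∈xs)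

sumℕ-unique : ∀ {A : Set} (f : A → ℕ) {xs ys} → Unique xs → Unique ys →
              (∀ {z} → z ∈ xs → z ∈ ys) → (∀ {z} → z ∈ ys → z ∈ xs) → sumℕ f xs ≡ sumℕ f ys
sumℕ-unique f {xs} {ys} ux uy to from = begin
  sumℕ f xs          ≡⟨ sumℕ≡sum-map xs ⟩
  sum (map f xs)     ≡⟨ sum-↭ (↭.map⁺ f (∼bag⇒↭ (unique∧set⇒bag ux uy (mk⇔ to from)))) ⟩
  sum (map f ys)     ≡⟨ sumℕ≡sum-map ys ⟨
  sumℕ f ys          ∎
  where
  open ≡-Reasoning
  sumℕ≡sum-map : ∀ xs → sumℕ f xs ≡ sum (map f xs)
  sumℕ≡sum-map []       = refl
  sumℕ≡sum-map (x ∷ xs) = cong (_+_ (f x)) (sumℕ≡sum-map xs)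

Unique-++-∷⁻ : ∀ {A : Set} (as : List A) {x bs} → Unique (as ++ x ∷ bs) → Unique (as ++ bs) × x ∉ as ++ bs
Unique-++-∷⁻ []       (x∉bs ∷ u) = u , λ x∈bs → All.lookup x∉bs x∈bs refl
Unique-++-∷⁻ (a ∷ as) {x} {bs} (a∉ ∷ u) with Unique-++-∷⁻ as u
... | u′ , x∉ = drop-x a∉ ∷ u′ , λ { (here refl) → All.lookup a∉ (∈-++⁺ʳ as (here refl)) refl
                                  ; (there x∈) → x∉ x∈ }
  where
  drop-x : All (a ≢_) (as ++ x ∷ bs) → All (a ≢_) (as ++ bs)
  drop-x a∉ with All.++⁻ as a∉
  ... | a∉as , _ ∷ a∉bs = All.++⁺ a∉as a∉bs

∈-++-∷⁺ : ∀ {A : Set} (as : List A) {x bs z} → z ∈ as ++ bs → z ∈ as ++ x ∷ bs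
∈-++-∷⁺ []       z∈         = there z∈
∈-++-∷⁺ (a ∷ as) (here z≡a) = here z≡a
∈-++-∷⁺ (a ∷ as) (there z∈) = there (∈-++-∷⁺ as z∈)

length-++-∷ : ∀ {A : Set} (as : List A) x bs → length (as ++ x ∷ bs) ≡ suc (length (as ++ bs))
length-++-∷ []       x bs = refl
length-++-∷ (a ∷ as) x bs = cong suc (length-++-∷ as x bs)

All<-drop : ∀ n xs → All (_< suc n) xs → n ∉ xs → All (_< n) xs
All<-drop n xs xs≤n n∉xs =
  All.tabulate (λ {z} z∈ → ≤∧≢⇒< (≤-pred (All.lookup xs≤n z∈)) (λ z≡n → n∉xs (subst (_∈ xs) z≡n z∈)))

Unique⇒length≤ : ∀ n xs → Unique xs → All (_< n) xs → length xs ≤ n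
Unique⇒length≤ zero    []       _    _          = z≤n
Unique⇒length≤ zero    (x ∷ xs) _    (() ∷ _)
Unique⇒length≤ (suc n) xs       uniq xs<1+n with n ∈? xs
... | no n∉xs = m≤n⇒m≤1+n (Unique⇒length≤ n xs uniq (All<-drop n xs xs<1+n n∉xs))
... | yes n∈xs with ∈-∃++ n∈xs
...   | as , bs , refl with Unique-++-∷⁻ as uniq
...     | uniq′ , n∉ = subst (_≤ suc n) (sym (length-++-∷ as n bs))
  (s≤s (Unique⇒length≤ n (as ++ bs) uniq′
          (All<-drop n (as ++ bs) (All.tabulate (λ z∈ → All.lookup xs<1+n (∈-++-∷⁺ as z∈))) n∉)))

remove : ℕ → List ℕ → List ℕ
remove v []      = []
remove v (z ∷ p) with v ≟ z
... | yes _ = p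
... | no  _ = z ∷ remove v p

remove-here : ∀ v r → remove v (v ∷ r) ≡ r
remove-here v r with v ≟ v
... | yes _   = refl
... | no  v≢v = ⊥-elim (v≢v refl)

remove-there : ∀ v z r → v ≢ z → remove v (z ∷ r) ≡ z ∷ remove v r
remove-there v z r v≢z with v ≟ z
... | yes v≡z = ⊥-elim (v≢z v≡z)
... | no  _   = refl

remove-insertions : ∀ v l p → All (v ≢_) p → All (λ g → remove v (result g) ≡ p) (insertions v l p)
remove-insertions v l []      _             = remove-here v [] ∷ []
remove-insertions v l (z ∷ p) (v≢z ∷ v∉p) =
  remove-here v (z ∷ p) ∷ All.map⁺ (All.map (λ {g} eq → trans (remove-there v z (result g) v≢z) (cong (z ∷_) eq))
                                                 (remove-insertions v (just z) p v∉p))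

map-result-prepend : ∀ z gs → map result (map (prepend z) gs) ≡ map (z ∷_) (map result gs)
map-result-prepend z []       = refl
map-result-prepend z (g ∷ gs) = cong ((z ∷ result g) ∷_) (map-result-prepend z gs)

Unique-insertions : ∀ v l p → All (v ≢_) p → Unique (map result (insertions v l p))
Unique-insertions v l []      _             = [] ∷ []
Unique-insertions v l (z ∷ p) (v≢z ∷ v∉p) rewrite map-result-prepend z (insertions v (just z) p) =
  All.map⁺ (All.tabulate (λ _ eq → v≢z (List.∷-injectiveˡ eq)))
  ∷ Unique.map⁺ List.∷-injectiveʳ (Unique-insertions v (just z) p v∉p)

∈-insertions : ∀ v l as bs → as ++ v ∷ bs ∈ map result (insertions v l (as ++ bs))
∈-insertions v l []       []       = here refl
∈-insertions v l []       (z ∷ bs) = here refl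
∈-insertions v l (a ∷ as) bs rewrite map-result-prepend a (insertions v (just a) (as ++ bs)) =
  there (∈-map⁺ (a ∷_) (∈-insertions v (just a) as bs))

insertionPerms-Unique : ∀ n → Unique (insertionPerms n)
insertionPerms-Unique zero    = [] ∷ []
insertionPerms-Unique (suc n) =
  Unique-concatMap (λ p → map result (insertions n nothing p)) (insertionPerms-Unique n)
    (λ {p} p∈ → Unique-insertions n nothing p (n∉ p∈)) disjoint
  where
  n∉ : ∀ {p} → p ∈ insertionPerms n → All (n ≢_) p
  n∉ {p} p∈ = <⇒≢-All p (proj₁ (All.lookup (insertionPerms-IsPerm n) p∈))
  recover : ∀ {p q} → p ∈ insertionPerms n → q ∈ map result (insertions n nothing p) → remove n q ≡ p
  recover {p} p∈ q∈ with ∈-map⁻ result q∈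
  ... | g , g∈ , refl = All.lookup (remove-insertions n nothing p (n∉ p∈)) g∈
  disjoint : ∀ {p p′ q} → p ∈ insertionPerms n → p′ ∈ insertionPerms n →
             q ∈ map result (insertions n nothing p) → q ∈ map result (insertions n nothing p′) → p ≡ p′
  disjoint p∈ p′∈ q∈ q∈′ = trans (sym (recover p∈ q∈)) (recover p′∈ q∈′)

IsPerm⇒∈insertionPerms : ∀ n q → IsPerm n q → q ∈ insertionPerms n
IsPerm⇒∈insertionPerms zero    []  _ = here refl
IsPerm⇒∈insertionPerms (suc n) q (q<1+n , uniq , len) with n ∈? q
... | no n∉q = ⊥-elim (<-irrefl refl (subst (_≤ n) len (Unique⇒length≤ n q uniq (All<-drop n q q<1+n n∉q))))
... | yes n∈q with ∈-∃++ n∈q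
...   | as , bs , refl with Unique-++-∷⁻ as uniq
...     | uniq′ , n∉ = ∈-concatMap⁺′ (λ p → map result (insertions n nothing p)) (∈-insertions n nothing as bs)
  (IsPerm⇒∈insertionPerms n (as ++ bs)
     (All<-drop n (as ++ bs) (All.tabulate (λ z∈ → All.lookup q<1+n (∈-++-∷⁺ as z∈))) n∉ ,
      uniq′ , suc-injective (trans (sym (length-++-∷ as n bs)) len)))

∈-words : ∀ n m (v : Vec (Fin m) n) → v ∈ words n m
∈-words zero    m []ᵥ       = here refl
∈-words (suc n) m (x ∷ᵥ v) =
  ∈-concatMap⁺′ (λ v → map (_∷ᵥ v) (allFin m)) (∈-map⁺ (_∷ᵥ v) (∈-allFin x)) (∈-words n m v)

Unique-words : ∀ n m → Unique (words n m)
Unique-words zero    m = [] ∷ []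
Unique-words (suc n) m = Unique-concatMap (λ v → map (_∷ᵥ v) (allFin m)) (Unique-words n m)
  (λ _ → Unique.map⁺ Vec.∷-injectiveˡ (Unique.allFin⁺ m)) disjoint
  where
  tail≡ : ∀ {v w} → w ∈ map (_∷ᵥ v) (allFin m) → Vec.tail w ≡ v
  tail≡ w∈ with ∈-map⁻ _ w∈
  ... | _ , _ , refl = refl
  disjoint : ∀ {v v′ w} → v ∈ words n m → v′ ∈ words n m →
             w ∈ map (_∷ᵥ v) (allFin m) → w ∈ map (_∷ᵥ v′) (allFin m) → v ≡ v′
  disjoint _ _ w∈ w∈′ = trans (sym (tail≡ w∈)) (tail≡ w∈′)

toNatList : ∀ {m k} → Vec (Fin m) k → List ℕ
toNatList v = map toℕ (toList v)

toNatList-injective : ∀ {m k} {v w : Vec (Fin m) k} → toNatList v ≡ toNatList w → v ≡ w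
toNatList-injective {v = []ᵥ}     {[]ᵥ}     _  = refl
toNatList-injective {v = x ∷ᵥ v} {y ∷ᵥ w} eq =
  cong₂ _∷ᵥ_ (Fin.toℕ-injective (List.∷-injectiveˡ eq)) (toNatList-injective (List.∷-injectiveʳ eq))

unique? : ∀ n (v : Vec (Fin n) n) → Dec (Unique (toList v))
unique? n v = UniqueDec.unique? (Fin._≟_ {n}) (toList v)

Unique-toNatList-perms : ∀ n → Unique (map toNatList (perms n))
Unique-toNatList-perms n = Unique.map⁺ toNatList-injective (Unique.filter⁺ (unique? n) (Unique-words n n))

∈perms⇒IsPerm : ∀ n q → q ∈ map toNatList (perms n) → IsPerm n q
∈perms⇒IsPerm n q q∈ with ∈-map⁻ toNatList q∈
... | v , v∈ , refl =
  All.map⁺ (All.tabulate (λ {x} _ → Fin.toℕ<n x)) ,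
  Unique.map⁺ Fin.toℕ-injective (proj₂ (∈-filter⁻ (unique? n) {v} {words n n} v∈)) ,
  trans (List.length-map toℕ (toList v)) (Vec.length-toList v)

fromNatList : ∀ {m} (xs : List ℕ) → All (_< m) xs → Vec (Fin m) (length xs)
fromNatList []       []            = []ᵥ
fromNatList (x ∷ xs) (x<m ∷ xs<m) = fromℕ< x<m ∷ᵥ fromNatList xs xs<m

toNatList-fromNatList : ∀ {m} xs (xs<m : All (_< m) xs) → toNatList (fromNatList xs xs<m) ≡ xs
toNatList-fromNatList []       []            = refl
toNatList-fromNatList (x ∷ xs) (x<m ∷ xs<m) = cong₂ _∷_ (Fin.toℕ-fromℕ< x<m) (toNatList-fromNatList xs xs<m)

toNatList-subst : ∀ {m a b} (eq : a ≡ b) (v : Vec (Fin m) a) → toNatList (subst (Vec (Fin m)) eq v) ≡ toNatList v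
toNatList-subst refl v = refl

IsPerm⇒∈perms : ∀ n q → IsPerm n q → q ∈ map toNatList (perms n)
IsPerm⇒∈perms n q (q<n , uniq , len) =
  subst (_∈ map toNatList (perms n)) v↦q (∈-map⁺ toNatList (∈-filter⁺ (unique? n) (∈-words n n v) v-unique))
  where
  v : Vec (Fin n) n
  v = subst (Vec (Fin n)) len (fromNatList q q<n)
  v↦q : toNatList v ≡ q
  v↦q = trans (toNatList-subst len (fromNatList q q<n)) (toNatList-fromNatList q q<n)
  v-unique : Unique (toList v)
  v-unique = Unique.map⁻ (subst Unique (sym v↦q) uniq)

a≡count : ∀ n k → a n k ≡ length (filter (λ q → bondsL q ≟ k) (insertionPerms n))
a≡count n k = begin
  length (filter (λ p → bonds p ≟ k) (perms n))
    ≡⟨ length-filter bonds k (perms n) ⟩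
  sumℕ (λ v → δ (bonds v) k) (perms n)
    ≡⟨ sumℕ-map (λ q → δ (bondsL q) k) toNatList (perms n) ⟨
  sumℕ (λ q → δ (bondsL q) k) (map toNatList (perms n))
    ≡⟨ sumℕ-unique (λ q → δ (bondsL q) k) (Unique-toNatList-perms n) (insertionPerms-Unique n)
         (λ {q} q∈ → IsPerm⇒∈insertionPerms n q (∈perms⇒IsPerm n q q∈))
         (λ {q} q∈ → IsPerm⇒∈perms n q (All.lookup (insertionPerms-IsPerm n) q∈)) ⟩
  sumℕ (λ q → δ (bondsL q) k) (insertionPerms n)
    ≡⟨ length-filter bondsL k (insertionPerms n) ⟨
  length (filter (λ q → bondsL q ≟ k) (insertionPerms n)) ∎
  where open ≡-Reasoning

theorem2 : (n k : ℕ) → F n k ≡ rhs n k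
theorem2 n k = trans (cong +_ (a≡count n k)) (sym (rhs≡count n k))
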